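{- Let $\alpha=(a,b,A,B)$ and $\alpha'=(a',b',A',B')$ be arcs of $\mathcal A_n$. (i) $\mathrm{SP}(\alpha)$ is a face of $\mathrm{SP}(\alpha')$ if and only if $\alpha$ forces $\alpha'$ and $a\in\{a'\}\cup A'$ and $b\in B'\cup\{b'\}$. (ii) If $\alpha$ forces $\alpha'$, then the translate of $\mathrm{SP}(\alpha)$ by the vector $\mathbf t_\alpha^{\alpha'}:=\delta_{a\in B'}(\mathbf e_{a'}-\mathbf e_a)+\delta_{b\in A'}(\mathbf e_b-\mathbf e_{b'})$ is a face of $\mathrm{SP}(\alpha')$. (iii) $\mathrm{SP}(\alpha')$ is the convex hull of $\mathbf 0$, $\mathbf e_{a'}-\mathbf e_{b'}$, and the vertices of the translated shard polytopes $\mathrm{SP}(\alpha)+\mathbf t_\alpha^{\alpha'}$ over all arcs $\alpha$ forcing $\alpha'$; moreover it suffices to take the arcs $\alpha$ cutting $\alpha'$.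
   Context: $]a,b[=\{a+1,\dots,b-1\}$, $(\mathbf e_i)$ is the standard basis of $\mathbb R^n$, $\delta_X=1$ if $X$ holds and $0$ otherwise. An arc is a quadruple $\alpha=(a,b,A,B)$ with $1\le a<b\le n$ and $A\sqcup B=]a,b[$; $\mathcal A_n$ is the set of arcs. An $\alpha$-alternating matching is a (possibly empty) set $M=\{a_1<b_1<\dots<a_k<b_k\}$ with $a\le a_1$, $b_k\le b$, $a_i\in\{a\}\cup A$ and $b_i\in B\cup\{b\}$; $\chi(M)=\sum_i(\mathbf e_{a_i}-\mathbf e_{b_i})$; the shard polytope is $\mathrm{SP}(\alpha)=\mathrm{conv}\{\chi(M)\}$ over all $\alpha$-alternating matchings $M$. The arc $\alpha=(a,b,A,B)$ forces $\alpha'=(a',b',A',B')$ if $a'\le a<b\le b'$, $A\subseteq A'$ and $B\subseteq B'$. The arc $\alpha$ cuts $\alpha'$ if $\alpha$ forces $\alpha'$ and $\alpha,\alpha'$ share an endpoint ($a=a'$ or $b=b'$). -}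

module Defs where

open import Data.Nat as ℕ using (ℕ; zero; suc)
open import Data.Fin as Fin using (Fin; toℕ)
open import Data.Fin.Subset using (Subset; _∈_; _⊆_)
open import Data.Fin.Subset.Properties using (_∈?_)
open import Data.Rational as ℚ using (ℚ; 0ℚ; 1ℚ; _+_; _*_; _-_; _≤_)
open import Data.List using (List; []; _∷_; map; foldr)
open import Data.List.Relation.Unary.All using (All)
open import Data.Product using (Σ; ∃; _×_; _,_; proj₁; proj₂)
open import Data.Sum using (_⊎_)
open import Data.Empty using (⊥)
open import Data.Bool using (if_then_else_)
open import Relation.Nullary using (Dec; does; ¬_)
open import Relation.Binary.PropositionalEquality using (_≡_)

-- Points of ℚ^n (coordinates indexed by Fin n; position i of the paper
-- is index i-1 here).

Point : ℕ → Set
Point n = Fin n → ℚ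

0ᵥ : ∀ {n} → Point n
0ᵥ _ = 0ℚ

_+ᵥ_ : ∀ {n} → Point n → Point n → Point n
(x +ᵥ y) i = x i + y i

_-ᵥ_ : ∀ {n} → Point n → Point n → Point n
(x -ᵥ y) i = x i - y i

_·ᵥ_ : ∀ {n} → ℚ → Point n → Point n
(c ·ᵥ x) i = c * x i

_≈ᵥ_ : ∀ {n} → Point n → Point n → Set
x ≈ᵥ y = ∀ i → x i ≡ y i

e : ∀ {n} → Fin n → Point n
e i j = if does (i Fin.≟ j) then 1ℚ else 0ℚ

sumFin : ∀ {n} → (Fin n → ℚ) → ℚ
sumFin {zero}  f = 0ℚ
sumFin {suc n} f = f Fin.zero + sumFin (λ i → f (Fin.suc i))

⟨_,_⟩ : ∀ {n} → Point n → Point n → ℚ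
⟨ x , y ⟩ = sumFin (λ i → x i * y i)

δ : ∀ {p} {P : Set p} → Dec P → ℚ
δ d = if does d then 1ℚ else 0ℚ

PointSet : ℕ → Set₁
PointSet n = Point n → Set

_≐_ : ∀ {n} → PointSet n → PointSet n → Set
P ≐ Q = ∀ x → (P x → Q x) × (Q x → P x)

wsum : ∀ {n} → List (ℚ × Point n) → Point n
wsum = foldr (λ wp acc → (proj₁ wp ·ᵥ proj₂ wp) +ᵥ acc) 0ᵥ

weights : ∀ {n} → List (ℚ × Point n) → ℚ
weights = foldr (λ wp acc → proj₁ wp + acc) 0ℚ

conv : ∀ {n} → PointSet n → PointSet n
conv S x = ∃ λ (L : List (_ × _)) →
  All (λ wp → (0ℚ ≤ proj₁ wp) × S (proj₂ wp)) L
  × weights L ≡ 1ℚ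
  × x ≈ᵥ wsum L

-- F is a face of P: F is the set of maximizers over P of some linear
-- functional c (c = 0 gives P itself).
IsFace : ∀ {n} → PointSet n → PointSet n → Set
IsFace {n} F P = ∃ λ (c : Point n) →
  ∀ x → (F x → P x × (∀ y → P y → ⟨ c , y ⟩ ≤ ⟨ c , x ⟩))
      × (P x × (∀ y → P y → ⟨ c , y ⟩ ≤ ⟨ c , x ⟩) → F x)

IsVertex : ∀ {n} → PointSet n → Point n → Set
IsVertex P x = IsFace (λ y → y ≈ᵥ x) P

_⊕_ : ∀ {n} → PointSet n → Point n → PointSet n
(P ⊕ t) y = P (y -ᵥ t)

_∪ₚ_ : ∀ {n} → PointSet n → PointSet n → PointSet n
(P ∪ₚ Q) x = P x ⊎ Q x

record Arc (n : ℕ) : Set where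
  field
    a b   : Fin n
    a<b   : a Fin.< b
    A B   : Subset n
    disj  : ∀ i → i ∈ A → i ∈ B → ⊥
    cover : ∀ i → (a Fin.< i × i Fin.< b) → i ∈ A ⊎ i ∈ B
    inside : ∀ i → i ∈ A ⊎ i ∈ B → a Fin.< i × i Fin.< b

open Arc public

Forces : ∀ {n} → Arc n → Arc n → Set
Forces α α' = (toℕ (a α') ℕ.≤ toℕ (a α)) × (toℕ (b α) ℕ.≤ toℕ (b α'))
            × (A α ⊆ A α') × (B α ⊆ B α')

Cuts : ∀ {n} → Arc n → Arc n → Set
Cuts α α' = Forces α α' × (a α ≡ a α' ⊎ b α ≡ b α')

SameArc : ∀ {n} → Arc n → Arc n → Set
SameArc α α' = (a α ≡ a α') × (b α ≡ b α') × (A α ≡ A α') × (B α ≡ B α')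

-- Alternating matchings, encoded as the list [(a₁,b₁),…,(a_k,b_k)]

-- Chain α lo M : M = (a₁,b₁)∷… with lo ≤ a₁ < b₁ < a₂ < … , each b_i ≤ b,
-- a_i ∈ {a} ∪ A, b_i ∈ B ∪ {b}.
data Chain {n} (α : Arc n) : ℕ → List (Fin n × Fin n) → Set where
  []  : ∀ {lo} → Chain α lo []
  _∷_ : ∀ {lo x y rest} →
        (lo ℕ.≤ toℕ x) × (x Fin.< y) × (toℕ y ℕ.≤ toℕ (b α))
          × (x ≡ a α ⊎ x ∈ A α) × (y ∈ B α ⊎ y ≡ b α) →
        Chain α (suc (toℕ y)) rest →
        Chain α lo ((x , y) ∷ rest)

AltMatching : ∀ {n} → Arc n → List (Fin n × Fin n) → Set
AltMatching α M = Chain α (toℕ (a α)) M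

χ : ∀ {n} → List (Fin n × Fin n) → Point n
χ = foldr (λ xy acc → (e (proj₁ xy) -ᵥ e (proj₂ xy)) +ᵥ acc) 0ᵥ

SP : ∀ {n} → Arc n → PointSet n
SP α = conv (λ x → ∃ λ M → AltMatching α M × x ≈ᵥ χ M)

t : ∀ {n} → Arc n → Arc n → Point n
t α α' = ((δ (a α ∈? B α')) ·ᵥ (e (a α') -ᵥ e (a α)))
      +ᵥ ((δ (b α ∈? A α')) ·ᵥ (e (b α) -ᵥ e (b α')))

Gen : ∀ {n} → (Arc n → Arc n → Set) → Arc n → PointSet n
Gen R α' x = (x ≈ᵥ 0ᵥ) ⊎ (x ≈ᵥ (e (a α') -ᵥ e (b α')))
  ⊎ (∃ λ α → R α α' × ¬ SameArc α α' × IsVertex (SP α ⊕ t α α') x)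

{-# OPTIONS --safe #-}
-- A matching M is encoded by the indicator sequence s of the union of its intervals [aᵢ, bᵢ): then χ(M) is the
-- discrete derivative Δ s, and alternation says where s may rise and fall. Pairing Δ s with the suffix sums of
-- weights ±1 gives Σ wₖ sₖ (summation by parts), so prescribing s at some positions amounts to maximizing a
-- linear functional; such prescriptions cut out faces of SP(α), and single sequences are its vertices.
-- (ii) The sequences of α correspond to the sequences of α′ equal to [a ∈ B′] on [a′, a) and to [b ∈ A′] on
-- [b, b′): add these runs, which translates Δ s by t. (i) The "if" part is (ii) with t = 0; for "only if",
-- each interval [u, v) alternating for α gives a vertex e_u - e_v of SP(α), hence of SP(α′), which forces u
-- and v to be admissible endpoints for α′. (iii) Any other matching of α′ than ∅ and {(a′, b′)} is, after
-- dropping its first pair if that starts at a′, a matching of the arc cut off from α′ at its first endpoint.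

module Submission where

open import Defs
open import Data.Nat as ℕ using (ℕ; zero; suc; z≤n; s≤s; _<ᵇ_; _≡ᵇ_; _∸_)
import Data.Nat.Properties as ℕₚ
open import Data.Fin as Fin using (Fin; toℕ; fromℕ<)
import Data.Fin.Properties as Finₚ
open import Data.Fin.Subset using (Subset; _∈_; _⊆_; _∩_)
open import Data.Fin.Subset.Properties using (_∈?_; x∈p∩q⁺; x∈p∩q⁻)
open import Data.Vec using (tabulate)
import Data.Vec.Properties as Vecₚ
open import Data.Rational as ℚ using (ℚ; 0ℚ; 1ℚ; _+_; _*_; _-_; -_; positive; nonNegative)
import Data.Rational.Properties as ℚₚ
open import Data.Bool using (Bool; true; false; T; not; if_then_else_; _∧_; _∨_)
import Data.Bool.Properties as Boolₚ
open import Data.Maybe using (Maybe; just; nothing)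
open import Data.List using (List; []; _∷_; foldr; map; _++_)
open import Data.List.Relation.Unary.All as All using (All; []; _∷_)
open import Data.List.Relation.Unary.All.Properties using (++⁺)
open import Data.Product using (Σ; ∃; _×_; _,_; proj₁; proj₂)
open import Data.Sum using (_⊎_; inj₁; inj₂)
open import Function using (_∘_)
open import Relation.Nullary using (¬_; Dec; yes; no; does; contradiction)
open import Relation.Nullary.Decidable using (dec-true; dec-false)
open import Relation.Binary.PropositionalEquality
open import Data.Rational.Solver
open +-*-Solver

-- Inner products and convex combinations

sumFin-cong : ∀ {n} {f g : Fin n → ℚ} → (∀ i → f i ≡ g i) → sumFin f ≡ sumFin g
sumFin-cong {zero}  h = refl
sumFin-cong {suc n} h = cong₂ _+_ (h Fin.zero) (sumFin-cong (λ i → h (Fin.suc i)))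

sumFin-+ : ∀ {n} (f g : Fin n → ℚ) → sumFin (λ i → f i + g i) ≡ sumFin f + sumFin g
sumFin-+ {zero}  f g = refl
sumFin-+ {suc n} f g =
  trans (cong ((f Fin.zero + g Fin.zero) +_) (sumFin-+ (λ i → f (Fin.suc i)) (λ i → g (Fin.suc i))))
        (solve 4 (λ a b c d → (a :+ b) :+ (c :+ d) := (a :+ c) :+ (b :+ d)) refl (f Fin.zero) (g Fin.zero) _ _)

sumFin-* : ∀ {n} (k : ℚ) (f : Fin n → ℚ) → sumFin (λ i → k * f i) ≡ k * sumFin f
sumFin-* {zero}  k f = sym (ℚₚ.*-zeroʳ k)
sumFin-* {suc n} k f = trans (cong ((k * f Fin.zero) +_) (sumFin-* k (λ i → f (Fin.suc i))))
                             (sym (ℚₚ.*-distribˡ-+ k (f Fin.zero) _))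

sumFin-0 : ∀ {n} → sumFin {n} (λ _ → 0ℚ) ≡ 0ℚ
sumFin-0 {zero}  = refl
sumFin-0 {suc n} = cong (0ℚ +_) (sumFin-0 {n})

⟨⟩-congʳ : ∀ {n} (c : Point n) {x y : Point n} → x ≈ᵥ y → ⟨ c , x ⟩ ≡ ⟨ c , y ⟩
⟨⟩-congʳ c x≈y = sumFin-cong (λ i → cong (c i *_) (x≈y i))

⟨⟩-0ᵥ : ∀ {n} (c : Point n) → ⟨ c , 0ᵥ ⟩ ≡ 0ℚ
⟨⟩-0ᵥ {n} c = trans (sumFin-cong (λ i → ℚₚ.*-zeroʳ (c i))) (sumFin-0 {n})

⟨⟩-+ᵥ : ∀ {n} (c x y : Point n) → ⟨ c , x +ᵥ y ⟩ ≡ ⟨ c , x ⟩ + ⟨ c , y ⟩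
⟨⟩-+ᵥ c x y = trans (sumFin-cong (λ i → ℚₚ.*-distribˡ-+ (c i) (x i) (y i)))
                    (sumFin-+ (λ i → c i * x i) (λ i → c i * y i))

⟨⟩-·ᵥ : ∀ {n} (c : Point n) (k : ℚ) (x : Point n) → ⟨ c , k ·ᵥ x ⟩ ≡ k * ⟨ c , x ⟩
⟨⟩-·ᵥ c k x = trans (sumFin-cong (λ i → solve 3 (λ a b d → a :* (b :* d) := b :* (a :* d)) refl (c i) k (x i)))
                    (sumFin-* k (λ i → c i * x i))

⟨⟩--ᵥ : ∀ {n} (c x y : Point n) → ⟨ c , x -ᵥ y ⟩ ≡ ⟨ c , x ⟩ - ⟨ c , y ⟩
⟨⟩--ᵥ c x y = begin
  ⟨ c , x -ᵥ y ⟩                  ≡⟨ sumFin-cong (λ i → solve 3 (λ a b d → a :* (b :- d) := a :* b :+ con (- 1ℚ) :* (a :* d))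
                                                              refl (c i) (x i) (y i)) ⟩
  sumFin (λ i → c i * x i + - 1ℚ * (c i * y i))
                                   ≡⟨ sumFin-+ (λ i → c i * x i) (λ i → - 1ℚ * (c i * y i)) ⟩
  ⟨ c , x ⟩ + sumFin (λ i → - 1ℚ * (c i * y i))
                                   ≡⟨ cong (⟨ c , x ⟩ +_) (sumFin-* (- 1ℚ) (λ i → c i * y i)) ⟩
  ⟨ c , x ⟩ + - 1ℚ * ⟨ c , y ⟩    ≡⟨ solve 2 (λ a b → a :+ con (- 1ℚ) :* b := a :- b) refl ⟨ c , x ⟩ ⟨ c , y ⟩ ⟩
  ⟨ c , x ⟩ - ⟨ c , y ⟩            ∎
  where open ≡-Reasoning

wval : ∀ {n} → Point n → List (ℚ × Point n) → ℚ
wval c = foldr (λ wp acc → proj₁ wp * ⟨ c , proj₂ wp ⟩ + acc) 0ℚ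

⟨⟩-wsum : ∀ {n} (c : Point n) (L : List (ℚ × Point n)) → ⟨ c , wsum L ⟩ ≡ wval c L
⟨⟩-wsum c []            = ⟨⟩-0ᵥ c
⟨⟩-wsum c ((w , p) ∷ L) = trans (⟨⟩-+ᵥ c _ _) (cong₂ _+_ (⟨⟩-·ᵥ c w p) (⟨⟩-wsum c L))

≈ᵥ-sym : ∀ {n} {x y : Point n} → x ≈ᵥ y → y ≈ᵥ x
≈ᵥ-sym x≈y i = sym (x≈y i)

≈ᵥ-trans : ∀ {n} {x y z : Point n} → x ≈ᵥ y → y ≈ᵥ z → x ≈ᵥ z
≈ᵥ-trans x≈y y≈z i = trans (x≈y i) (y≈z i)

≐-sym : ∀ {n} {P Q : PointSet n} → P ≐ Q → Q ≐ P
≐-sym P≐Q x = proj₂ (P≐Q x) , proj₁ (P≐Q x)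

≐-trans : ∀ {n} {P Q R : PointSet n} → P ≐ Q → Q ≐ R → P ≐ R
≐-trans P≐Q Q≐R x = (λ Px → proj₁ (Q≐R x) (proj₁ (P≐Q x) Px)) , (λ Rx → proj₂ (P≐Q x) (proj₂ (Q≐R x) Rx))

Resp≈ : ∀ {n} → PointSet n → Set
Resp≈ P = ∀ {x y} → x ≈ᵥ y → P x → P y

ConvTerm : ∀ {n} → PointSet n → ℚ × Point n → Set
ConvTerm S wp = (0ℚ ℚ.≤ proj₁ wp) × S (proj₂ wp)

conv-resp : ∀ {n} (S : PointSet n) → Resp≈ (conv S)
conv-resp S x≈y (L , terms , w≡1 , x≈L) = L , terms , w≡1 , ≈ᵥ-trans (≈ᵥ-sym x≈y) x≈L

conv-mono : ∀ {n} {S T : PointSet n} → (∀ x → S x → T x) → ∀ x → conv S x → conv T x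
conv-mono S⊆T x (L , terms , w≡1 , x≈L) = L , All.map (λ (w≥0 , s) → w≥0 , S⊆T _ s) terms , w≡1 , x≈L

conv-extensive : ∀ {n} {S : PointSet n} x → S x → conv S x
conv-extensive x s = ((1ℚ , x) ∷ []) , ((ℚₚ.≤ᵇ⇒≤ _ , s) ∷ []) , refl ,
  λ i → solve 1 (λ a → a := con 1ℚ :* a :+ con 0ℚ) refl (x i)

scale : ∀ {n} → ℚ → List (ℚ × Point n) → List (ℚ × Point n)
scale w = map (λ (v , p) → w * v , p)

wsum-scale : ∀ {n} w (L : List (ℚ × Point n)) → wsum (scale w L) ≈ᵥ (w ·ᵥ wsum L)
wsum-scale w []            i = sym (ℚₚ.*-zeroʳ w)
wsum-scale w ((v , p) ∷ L) i = trans (cong ((w * v) * p i +_) (wsum-scale w L i))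
  (solve 4 (λ w v p r → (w :* v) :* p :+ w :* r := w :* (v :* p :+ r)) refl w v (p i) (wsum L i))

weights-scale : ∀ {n} w (L : List (ℚ × Point n)) → weights (scale w L) ≡ w * weights L
weights-scale w []            = sym (ℚₚ.*-zeroʳ w)
weights-scale w ((v , p) ∷ L) = trans (cong ((w * v) +_) (weights-scale w L)) (sym (ℚₚ.*-distribˡ-+ w v _))

scale-terms : ∀ {n} {S : PointSet n} {w} → 0ℚ ℚ.≤ w → ∀ L → All (ConvTerm S) L → All (ConvTerm S) (scale w L)
scale-terms         w≥0 []      []                  = []
scale-terms {w = w} w≥0 (_ ∷ L) ((v≥0 , s) ∷ terms) =
  (ℚₚ.≤-trans (ℚₚ.≤-reflexive (sym (ℚₚ.*-zeroʳ w))) (ℚₚ.*-monoˡ-≤-nonNeg w {{nonNegative w≥0}} v≥0) , s)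
  ∷ scale-terms w≥0 L terms

wsum-++ : ∀ {n} (L K : List (ℚ × Point n)) → wsum (L ++ K) ≈ᵥ (wsum L +ᵥ wsum K)
wsum-++ []            K i = sym (ℚₚ.+-identityˡ _)
wsum-++ ((v , p) ∷ L) K i = trans (cong (v * p i +_) (wsum-++ L K i)) (sym (ℚₚ.+-assoc (v * p i) (wsum L i) (wsum K i)))

weights-++ : ∀ {n} (L K : List (ℚ × Point n)) → weights (L ++ K) ≡ weights L + weights K
weights-++ []            K = sym (ℚₚ.+-identityˡ _)
weights-++ ((v , p) ∷ L) K = trans (cong (v +_) (weights-++ L K)) (sym (ℚₚ.+-assoc v (weights L) (weights K)))

flatten : ∀ {n} {S : PointSet n} (L : List (ℚ × Point n)) → All (ConvTerm (conv S)) L →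
  Σ (List (ℚ × Point n)) λ K → All (ConvTerm S) K × weights K ≡ weights L × wsum K ≈ᵥ wsum L
flatten [] [] = [] , [] , refl , λ i → refl
flatten ((w , p) ∷ L) ((w≥0 , (Lp , terms-p , wp≡1 , p≈Lp)) ∷ terms) with flatten L terms
... | K , terms-K , wK , K≈L =
  scale w Lp ++ K ,
  ++⁺ (scale-terms w≥0 Lp terms-p) terms-K ,
  trans (weights-++ (scale w Lp) K)
        (cong₂ _+_ (trans (weights-scale w Lp) (trans (cong (w *_) wp≡1) (ℚₚ.*-identityʳ w))) wK) ,
  λ i → trans (wsum-++ (scale w Lp) K i) (cong₂ _+_ (trans (wsum-scale w Lp i) (cong (w *_) (sym (p≈Lp i)))) (K≈L i))

conv-idem : ∀ {n} (S : PointSet n) x → conv (conv S) x → conv S x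
conv-idem S x (L , terms , w≡1 , x≈L) with flatten L terms
... | K , terms-K , wK , K≈L = K , terms-K , trans wK w≡1 , λ i → trans (x≈L i) (sym (K≈L i))

shift : ∀ {n} → Point n → List (ℚ × Point n) → List (ℚ × Point n)
shift u = map (λ (w , p) → w , p +ᵥ u)

wsum-shift : ∀ {n} u (L : List (ℚ × Point n)) → wsum (shift u L) ≈ᵥ (wsum L +ᵥ (weights L ·ᵥ u))
wsum-shift u []            i = solve 1 (λ u → con 0ℚ := con 0ℚ :+ con 0ℚ :* u) refl (u i)
wsum-shift u ((v , p) ∷ L) i = trans (cong (v * (p i + u i) +_) (wsum-shift u L i))
  (solve 5 (λ v p u r w → v :* (p :+ u) :+ (r :+ w :* u) := (v :* p :+ r) :+ (v :+ w) :* u) refl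
     v (p i) (u i) (wsum L i) (weights L))

weights-shift : ∀ {n} u (L : List (ℚ × Point n)) → weights (shift u L) ≡ weights L
weights-shift u []            = refl
weights-shift u ((v , p) ∷ L) = cong (v +_) (weights-shift u L)

shift-terms : ∀ {n} {S T : PointSet n} (u : Point n) → (∀ p → S p → T (p +ᵥ u)) →
  ∀ L → All (ConvTerm S) L → All (ConvTerm T) (shift u L)
shift-terms u S⇒T []      []                  = []
shift-terms u S⇒T (_ ∷ L) ((w≥0 , s) ∷ terms) = (w≥0 , S⇒T _ s) ∷ shift-terms u S⇒T L terms

conv-shift : ∀ {n} {S T : PointSet n} (u : Point n) → (∀ p → S p → T (p +ᵥ u)) →
  ∀ x → conv S x → conv T (x +ᵥ u)
conv-shift u S⇒T x (L , terms , w≡1 , x≈L) =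
  shift u L , shift-terms u S⇒T L terms , trans (weights-shift u L) w≡1 ,
  λ i → trans (cong₂ _+_ (x≈L i) (sym (ℚₚ.*-identityˡ (u i))))
          (trans (cong (λ w → wsum L i + w * u i) (sym w≡1)) (sym (wsum-shift u L i)))

conv-⊕ : ∀ {n} (S : PointSet n) (t : Point n) → Resp≈ S → (conv S ⊕ t) ≐ conv (S ⊕ t)
conv-⊕ S t S-resp x = to , from
  where
  to : (conv S ⊕ t) x → conv (S ⊕ t) x
  to cx = conv-resp _ (λ i → solve 2 (λ x t → (x :- t) :+ t := x) refl (x i) (t i))
    (conv-shift t (λ p → S-resp (λ i → solve 2 (λ p t → p := (p :+ t) :- t) refl (p i) (t i))) _ cx)
  from : conv (S ⊕ t) x → (conv S ⊕ t) x
  from cx = conv-resp _ (λ i → solve 2 (λ x t → x :+ con (- 1ℚ) :* t := x :- t) refl (x i) (t i))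
    (conv-shift ((- 1ℚ) ·ᵥ t) (λ p → S-resp (λ i → solve 2 (λ p t → p :- t := p :+ con (- 1ℚ) :* t) refl (p i) (t i))) _ cx)

-- Faces of convex hulls

PosTerm : ∀ {n} → PointSet n → ℚ × Point n → Set
PosTerm S wp = (0ℚ ℚ.< proj₁ wp) × S (proj₂ wp)

drop-zero-weights : ∀ {n} {S : PointSet n} (L : List (ℚ × Point n)) → All (ConvTerm S) L →
  Σ (List (ℚ × Point n)) λ K → All (PosTerm S) K × weights K ≡ weights L × wsum K ≈ᵥ wsum L
drop-zero-weights [] [] = [] , [] , refl , λ i → refl
drop-zero-weights ((w , p) ∷ L) ((w≥0 , s) ∷ terms) with drop-zero-weights L terms | 0ℚ ℚₚ.<? w
... | K , terms-K , wK , K≈L | yes w>0 =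
  (w , p) ∷ K , (w>0 , s) ∷ terms-K , cong (w +_) wK , λ i → cong (w * p i +_) (K≈L i)
... | K , terms-K , wK , K≈L | no w≯0 rewrite ℚₚ.≤-antisym (ℚₚ.≮⇒≥ w≯0) w≥0 =
  K , terms-K , trans wK (sym (ℚₚ.+-identityˡ _)) ,
  λ i → trans (K≈L i) (solve 2 (λ a b → b := con 0ℚ :* a :+ b) refl (p i) (wsum L i))

+-tight : ∀ {a b x y : ℚ} → a ℚ.≤ x → b ℚ.≤ y → x + y ℚ.≤ a + b → (a ≡ x) × (b ≡ y)
+-tight {a} {b} {x} {y} a≤x b≤y x+y≤a+b = a≡x , b≡y
  where
  a≡x : a ≡ x
  a≡x with x ℚₚ.≤? a
  ... | yes x≤a = ℚₚ.≤-antisym a≤x x≤a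
  ... | no x≰a  = contradiction (ℚₚ.≤-<-trans x+y≤a+b (ℚₚ.+-mono-<-≤ (ℚₚ.≰⇒> x≰a) b≤y)) (ℚₚ.<-irrefl refl)
  b≡y : b ≡ y
  b≡y with y ℚₚ.≤? b
  ... | yes y≤b = ℚₚ.≤-antisym b≤y y≤b
  ... | no y≰b  = contradiction (ℚₚ.≤-<-trans x+y≤a+b (ℚₚ.+-mono-≤-< a≤x (ℚₚ.≰⇒> y≰b))) (ℚₚ.<-irrefl refl)

*-cancelˡ-pos : ∀ {w p q : ℚ} → 0ℚ ℚ.< w → w * p ≡ w * q → p ≡ q
*-cancelˡ-pos {w} w>0 eq = ℚₚ.≤-antisym
  (ℚₚ.*-cancelˡ-≤-pos w {{positive w>0}} (ℚₚ.≤-reflexive eq))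
  (ℚₚ.*-cancelˡ-≤-pos w {{positive w>0}} (ℚₚ.≤-reflexive (sym eq)))

wval-≤ : ∀ {n} (c : Point n) (M : ℚ) (L : List (ℚ × Point n)) →
  All (ConvTerm (λ p → ⟨ c , p ⟩ ℚ.≤ M)) L → wval c L ℚ.≤ weights L * M
wval-≤ c M []            []                  = ℚₚ.≤-reflexive (sym (ℚₚ.*-zeroˡ M))
wval-≤ c M ((w , p) ∷ L) ((w≥0 , cp≤M) ∷ terms) =
  ℚₚ.≤-trans (ℚₚ.+-mono-≤ (ℚₚ.*-monoˡ-≤-nonNeg w {{nonNegative w≥0}} cp≤M) (wval-≤ c M L terms))
             (ℚₚ.≤-reflexive (sym (ℚₚ.*-distribʳ-+ M w (weights L))))

wval-tight : ∀ {n} (c : Point n) (M : ℚ) (L : List (ℚ × Point n)) →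
  All (PosTerm (λ p → ⟨ c , p ⟩ ℚ.≤ M)) L → weights L * M ℚ.≤ wval c L →
  All (λ wp → ⟨ c , proj₂ wp ⟩ ≡ M) L
wval-tight c M []            []                    _ = []
wval-tight c M ((w , p) ∷ L) ((w>0 , cp≤M) ∷ terms) bound
  with +-tight (ℚₚ.*-monoˡ-≤-nonNeg w {{nonNegative (ℚₚ.<⇒≤ w>0)}} cp≤M)
               (wval-≤ c M L (All.map (λ (w>0 , q) → ℚₚ.<⇒≤ w>0 , q) terms))
               (ℚₚ.≤-trans (ℚₚ.≤-reflexive (sym (ℚₚ.*-distribʳ-+ M w (weights L)))) bound)
... | head≡ , tail≡ = *-cancelˡ-pos w>0 head≡ ∷ wval-tight c M L terms (ℚₚ.≤-reflexive (sym tail≡))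

wval-const : ∀ {n} (c : Point n) (M : ℚ) (L : List (ℚ × Point n)) →
  All (λ wp → ⟨ c , proj₂ wp ⟩ ≡ M) L → wval c L ≡ weights L * M
wval-const c M []            []         = sym (ℚₚ.*-zeroˡ M)
wval-const c M ((w , p) ∷ L) (cp≡M ∷ L≡M) =
  trans (cong₂ _+_ (cong (w *_) cp≡M) (wval-const c M L L≡M)) (sym (ℚₚ.*-distribʳ-+ M w (weights L)))

⟨⟩-convex : ∀ {n} (c : Point n) {x : Point n} (L : List (ℚ × Point n)) → x ≈ᵥ wsum L → ⟨ c , x ⟩ ≡ wval c L
⟨⟩-convex c L x≈L = trans (⟨⟩-congʳ c x≈L) (⟨⟩-wsum c L)

weight-one : ∀ {n} (L : List (ℚ × Point n)) M → weights L ≡ 1ℚ → weights L * M ≡ M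
weight-one L M w≡1 = trans (cong (_* M) w≡1) (ℚₚ.*-identityˡ M)

conv-≤ : ∀ {n} {S : PointSet n} (c : Point n) (M : ℚ) → (∀ x → S x → ⟨ c , x ⟩ ℚ.≤ M) →
  ∀ x → conv S x → ⟨ c , x ⟩ ℚ.≤ M
conv-≤ c M S≤M x (L , terms , w≡1 , x≈L) =
  ℚₚ.≤-trans (ℚₚ.≤-reflexive (⟨⟩-convex c L x≈L))
    (ℚₚ.≤-trans (wval-≤ c M L (All.map (λ (w≥0 , s) → w≥0 , S≤M _ s) terms)) (ℚₚ.≤-reflexive (weight-one L M w≡1)))

-- A maximizer of c over conv S puts positive weight only on points of T.
maximizers-face : ∀ {n} (S T : PointSet n) (c : Point n) (M : ℚ) →
  (∀ x → S x → ⟨ c , x ⟩ ℚ.≤ M) →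
  (∀ x → T x → S x × ⟨ c , x ⟩ ≡ M) →
  (∀ x → S x → ⟨ c , x ⟩ ≡ M → T x) →
  ∃ T → IsFace (conv T) (conv S)
maximizers-face {n} S T c M S≤M T⇒S S⇒T (x₀ , Tx₀) = c , λ x → to x , from x
  where
  to : ∀ x → conv T x → conv S x × (∀ y → conv S y → ⟨ c , y ⟩ ℚ.≤ ⟨ c , x ⟩)
  to x cx@(L , terms , w≡1 , x≈L) =
    conv-mono (λ z Tz → proj₁ (T⇒S z Tz)) x cx ,
    λ y cy → ℚₚ.≤-trans (conv-≤ c M S≤M y cy) (ℚₚ.≤-reflexive (sym cx≡M))
    where
    cx≡M : ⟨ c , x ⟩ ≡ M
    cx≡M = trans (⟨⟩-convex c L x≈L)
             (trans (wval-const c M L (All.map (λ (_ , Tp) → proj₂ (T⇒S _ Tp)) terms)) (weight-one L M w≡1))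
  in-T : (K : List (ℚ × Point n)) → All (PosTerm S) K → All (λ wp → ⟨ c , proj₂ wp ⟩ ≡ M) K → All (ConvTerm T) K
  in-T []      []                []              = []
  in-T (_ ∷ K) ((w>0 , s) ∷ pos) (cp≡M ∷ K≡M) = (ℚₚ.<⇒≤ w>0 , S⇒T _ s cp≡M) ∷ in-T K pos K≡M
  from : ∀ x → conv S x × (∀ y → conv S y → ⟨ c , y ⟩ ℚ.≤ ⟨ c , x ⟩) → conv T x
  from x ((L , terms , w≡1 , x≈L) , max) with drop-zero-weights L terms
  ... | K , pos , wK , K≈L = K , in-T K pos K≡M , trans wK w≡1 , x≈K
    where
    x≈K : x ≈ᵥ wsum K
    x≈K i = trans (x≈L i) (sym (K≈L i))
    M≤cx : M ℚ.≤ ⟨ c , x ⟩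
    M≤cx = ℚₚ.≤-trans (ℚₚ.≤-reflexive (sym (proj₂ (T⇒S x₀ Tx₀))))
                      (max x₀ (conv-extensive x₀ (proj₁ (T⇒S x₀ Tx₀))))
    K≡M : All (λ wp → ⟨ c , proj₂ wp ⟩ ≡ M) K
    K≡M = wval-tight c M K (All.map (λ (w>0 , s) → w>0 , S≤M _ s) pos)
            (ℚₚ.≤-trans (ℚₚ.≤-reflexive (weight-one K M (trans wK w≡1)))
              (ℚₚ.≤-trans M≤cx (ℚₚ.≤-reflexive (⟨⟩-convex c K x≈K))))

IsFace-respˡ : ∀ {n} {F F' P : PointSet n} → F ≐ F' → IsFace F P → IsFace F' P
IsFace-respˡ F≐F' (c , face) = c , λ x →
  (λ F'x → proj₁ (face x) (proj₂ (F≐F' x) F'x)) , (λ max → proj₁ (F≐F' x) (proj₂ (face x) max))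

IsFace-respʳ : ∀ {n} {F P P' : PointSet n} → P ≐ P' → IsFace F P → IsFace F P'
IsFace-respʳ P≐P' (c , face) = c , λ x →
  (λ Fx → proj₁ (P≐P' x) (proj₁ (proj₁ (face x) Fx)) ,
          λ y P'y → proj₂ (proj₁ (face x) Fx) y (proj₂ (P≐P' y) P'y)) ,
  (λ (P'x , max) → proj₂ (face x) (proj₂ (P≐P' x) P'x , λ y Py → max y (proj₁ (P≐P' y) Py)))

⟨⟩--ᵥ-mono : ∀ {n} (c t y x : Point n) → ⟨ c , y ⟩ ℚ.≤ ⟨ c , x ⟩ → ⟨ c , y -ᵥ t ⟩ ℚ.≤ ⟨ c , x -ᵥ t ⟩
⟨⟩--ᵥ-mono c t y x cy≤cx = ℚₚ.≤-trans (ℚₚ.≤-reflexive (⟨⟩--ᵥ c y t))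
  (ℚₚ.≤-trans (ℚₚ.+-monoˡ-≤ (- ⟨ c , t ⟩) cy≤cx) (ℚₚ.≤-reflexive (sym (⟨⟩--ᵥ c x t))))

⟨⟩--ᵥ-cancel : ∀ {n} (c t y x : Point n) → ⟨ c , y -ᵥ t ⟩ ℚ.≤ ⟨ c , x -ᵥ t ⟩ → ⟨ c , y ⟩ ℚ.≤ ⟨ c , x ⟩
⟨⟩--ᵥ-cancel c t y x le = ℚₚ.≤-trans (ℚₚ.≤-reflexive (solve 2 (λ a b → a := (a :- b) :+ b) refl ⟨ c , y ⟩ ⟨ c , t ⟩))
  (ℚₚ.≤-trans (ℚₚ.+-monoˡ-≤ ⟨ c , t ⟩
                (ℚₚ.≤-trans (ℚₚ.≤-reflexive (sym (⟨⟩--ᵥ c y t))) (ℚₚ.≤-trans le (ℚₚ.≤-reflexive (⟨⟩--ᵥ c x t)))))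
    (ℚₚ.≤-reflexive (solve 2 (λ a b → (a :- b) :+ b := a) refl ⟨ c , x ⟩ ⟨ c , t ⟩)))

IsFace-⊕ : ∀ {n} {F P : PointSet n} (t : Point n) → Resp≈ P → IsFace F P → IsFace (F ⊕ t) (P ⊕ t)
IsFace-⊕ {F = F} {P} t P-resp (c , face) = c , λ x → to x , from x
  where
  to : ∀ x → (F ⊕ t) x → (P ⊕ t) x × (∀ y → (P ⊕ t) y → ⟨ c , y ⟩ ℚ.≤ ⟨ c , x ⟩)
  to x Fx = proj₁ (proj₁ (face (x -ᵥ t)) Fx) ,
            λ y Py → ⟨⟩--ᵥ-cancel c t y x (proj₂ (proj₁ (face (x -ᵥ t)) Fx) (y -ᵥ t) Py)
  from : ∀ x → (P ⊕ t) x × (∀ y → (P ⊕ t) y → ⟨ c , y ⟩ ℚ.≤ ⟨ c , x ⟩) → (F ⊕ t) x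
  from x (Px , max) = proj₂ (face (x -ᵥ t)) (Px , λ z Pz →
    ℚₚ.≤-trans (ℚₚ.≤-reflexive (⟨⟩-congʳ c z≈z+t-t))
      (⟨⟩--ᵥ-mono c t (z +ᵥ t) x (max (z +ᵥ t) (P-resp z≈z+t-t Pz))))
    where
    z≈z+t-t : ∀ {z} → z ≈ᵥ ((z +ᵥ t) -ᵥ t)
    z≈z+t-t {z} i = solve 2 (λ z t → z := (z :+ t) :- t) refl (z i) (t i)

IsFace⇒⊆ : ∀ {n} {F P : PointSet n} → IsFace F P → ∀ x → F x → P x
IsFace⇒⊆ (_ , face) x Fx = proj₁ (proj₁ (face x) Fx)

nonempty : ∀ {n} {P : PointSet n} (L : List (ℚ × Point n)) → All (λ wp → P (proj₂ wp)) L → weights L ≡ 1ℚ → ∃ P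
nonempty ((_ , p) ∷ L) (Pp ∷ _) _ = p , Pp

-- The terms of a positive combination of points of S representing v maximize c, so lie in F,
-- and then maximize d over F, so equal v.
vertex-of-face : ∀ {n} {F : PointSet n} (S : PointSet n) (v : Point n) →
  IsFace F (conv S) → IsVertex F v → ∃ λ g → S g × g ≈ᵥ v
vertex-of-face {n} {F} S v (c , face) (d , vertex)
  with proj₁ (vertex v) (λ i → refl)
... | Fv , d-max with proj₁ (face v) Fv
... | (L , terms , w≡1 , v≈L) , c-max with drop-zero-weights L terms
... | K , pos , wK , K≈L = nonempty K (at-v K posF (attains d (λ y (_ , Fy) → d-max y Fy) posF)) (trans wK w≡1)
  where
  v≈K : v ≈ᵥ wsum K
  v≈K i = trans (v≈L i) (sym (K≈L i))
  attains : (f : Point n) {P : PointSet n} → (∀ y → P y → ⟨ f , y ⟩ ℚ.≤ ⟨ f , v ⟩) → All (PosTerm P) K →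
    All (λ wp → ⟨ f , proj₂ wp ⟩ ≡ ⟨ f , v ⟩) K
  attains f f-max pos′ = wval-tight f ⟨ f , v ⟩ K (All.map (λ (w>0 , p) → w>0 , f-max _ p) pos′)
    (ℚₚ.≤-reflexive (trans (weight-one K _ (trans wK w≡1)) (⟨⟩-convex f K v≈K)))
  in-F : ∀ K′ → All (PosTerm S) K′ → All (λ wp → ⟨ c , proj₂ wp ⟩ ≡ ⟨ c , v ⟩) K′ →
    All (PosTerm (λ y → S y × F y)) K′
  in-F []       []                []          = []
  in-F (_ ∷ K′) ((w>0 , s) ∷ pos′) (c≡ ∷ K′≡) =
    (w>0 , s , proj₂ (face _) (conv-extensive _ s , λ y Py → ℚₚ.≤-trans (c-max y Py) (ℚₚ.≤-reflexive (sym c≡))))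
    ∷ in-F K′ pos′ K′≡
  posF : All (PosTerm (λ y → S y × F y)) K
  posF = in-F K pos (attains c (λ y s → c-max y (conv-extensive y s)) pos)
  at-v : ∀ K′ → All (PosTerm (λ y → S y × F y)) K′ → All (λ wp → ⟨ d , proj₂ wp ⟩ ≡ ⟨ d , v ⟩) K′ →
    All (λ wp → S (proj₂ wp) × proj₂ wp ≈ᵥ v) K′
  at-v []       []                    []          = []
  at-v (_ ∷ K′) ((_ , s , Fy) ∷ pos′) (d≡ ∷ K′≡) =
    (s , proj₂ (vertex _) (Fy , λ z Fz → ℚₚ.≤-trans (d-max z Fz) (ℚₚ.≤-reflexive (sym d≡)))) ∷ at-v K′ pos′ K′≡

-- Indicator sequences

T⇒≡true : ∀ {b} → T b → b ≡ true
T⇒≡true {true} _ = refl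

≡true⇒T : ∀ {b} → b ≡ true → T b
≡true⇒T refl = _

¬T⇒≡false : ∀ {b} → ¬ T b → b ≡ false
¬T⇒≡false {false} _  = refl
¬T⇒≡false {true}  ¬t = contradiction _ ¬t

≢true⇒≡false : ∀ {b} → b ≢ true → b ≡ false
≢true⇒≡false b≢true = ¬T⇒≡false (λ t → b≢true (T⇒≡true t))

∨≡true : ∀ x {y} → x ∨ y ≡ true → x ≡ true ⊎ y ≡ true
∨≡true true  _ = inj₁ refl
∨≡true false h = inj₂ h

<ᵇ≡true⇒< : ∀ {m n} → (m <ᵇ n) ≡ true → m ℕ.< n
<ᵇ≡true⇒< {m} {n} h = ℕₚ.<ᵇ⇒< m n (≡true⇒T h)

<⇒<ᵇ≡true : ∀ {m n} → m ℕ.< n → (m <ᵇ n) ≡ true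
<⇒<ᵇ≡true m<n = T⇒≡true (ℕₚ.<⇒<ᵇ m<n)

<ᵇ≡false⇒≥ : ∀ {m n} → (m <ᵇ n) ≡ false → n ℕ.≤ m
<ᵇ≡false⇒≥ h = ℕₚ.≮⇒≥ (λ m<n → subst T h (ℕₚ.<⇒<ᵇ m<n))

≥⇒<ᵇ≡false : ∀ {m n} → n ℕ.≤ m → (m <ᵇ n) ≡ false
≥⇒<ᵇ≡false {m} {n} n≤m = ¬T⇒≡false (λ t → ℕₚ.≤⇒≯ n≤m (ℕₚ.<ᵇ⇒< m n t))

bit : Bool → ℚ
bit true  = 1ℚ
bit false = 0ℚ

bit-∨ : ∀ x y → (x ≡ true → y ≡ false) → bit (x ∨ y) ≡ bit x + bit y
bit-∨ true  true  disjoint with () ← disjoint refl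
bit-∨ true  false _ = refl
bit-∨ false true  _ = refl
bit-∨ false false _ = refl

bit-injective : ∀ {x y} → bit x ≡ bit y → x ≡ y
bit-injective {true}  {true}  _ = refl
bit-injective {false} {false} _ = refl

beforeFrom : Bool → (ℕ → Bool) → ℕ → Bool
beforeFrom p s zero    = p
beforeFrom p s (suc k) = s k

before : (ℕ → Bool) → ℕ → Bool
before = beforeFrom false

Δℕ : (ℕ → Bool) → ℕ → ℚ
Δℕ s k = bit (s k) - bit (before s k)

Δ : ∀ {n} → (ℕ → Bool) → Point n
Δ s i = Δℕ s (toℕ i)

interval : ℕ → ℕ → ℕ → Bool
interval u v k = not (k <ᵇ u) ∧ (k <ᵇ v)

interval≡true⇒ : ∀ {u v k} → interval u v k ≡ true → u ℕ.≤ k × k ℕ.< v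
interval≡true⇒ {u} {v} {k} h with k <ᵇ u in k<ᵇu
... | false = <ᵇ≡false⇒≥ k<ᵇu , <ᵇ≡true⇒< h

interval≡false⇒ : ∀ {u v k} → interval u v k ≡ false → k ℕ.< u ⊎ v ℕ.≤ k
interval≡false⇒ {u} {v} {k} h with k <ᵇ u in k<ᵇu
... | true  = inj₁ (<ᵇ≡true⇒< k<ᵇu)
... | false = inj₂ (<ᵇ≡false⇒≥ h)

interval-inside : ∀ {u v k} → u ℕ.≤ k → k ℕ.< v → interval u v k ≡ true
interval-inside u≤k k<v rewrite ≥⇒<ᵇ≡false u≤k | <⇒<ᵇ≡true k<v = refl

interval-outside : ∀ {u v k} → k ℕ.< u ⊎ v ℕ.≤ k → interval u v k ≡ false
interval-outside {u} {v} {k} (inj₁ k<u) rewrite <⇒<ᵇ≡true k<u = refl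
interval-outside {u} {v} {k} (inj₂ v≤k) rewrite ≥⇒<ᵇ≡false v≤k = Boolₚ.∧-zeroʳ (not (k <ᵇ u))

e-toℕ : ∀ {n} (u i : Fin n) → e u i ≡ bit (toℕ u ≡ᵇ toℕ i)
e-toℕ u i with u Fin.≟ i
... | yes refl = cong bit (sym (T⇒≡true (ℕₚ.≡⇒≡ᵇ (toℕ u) (toℕ u) refl)))
... | no u≢i   = cong bit (sym (¬T⇒≡false (λ t → u≢i (Finₚ.toℕ-injective (ℕₚ.≡ᵇ⇒≡ (toℕ u) (toℕ i) t)))))

<ᵇ-suc : ∀ k v → bit (k <ᵇ suc v) ≡ bit (k <ᵇ v) + bit (v ≡ᵇ k)
<ᵇ-suc zero    zero    = refl
<ᵇ-suc zero    (suc v) = refl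
<ᵇ-suc (suc k) zero    = refl
<ᵇ-suc (suc k) (suc v) = <ᵇ-suc k v

Δℕ-interval : ∀ u v k → u ℕ.≤ v → Δℕ (interval u v) k ≡ bit (u ≡ᵇ k) - bit (v ≡ᵇ k)
Δℕ-interval zero    zero    zero    _ = refl
Δℕ-interval zero    (suc v) zero    _ = refl
Δℕ-interval (suc u) (suc v) zero    _ = refl
Δℕ-interval zero    zero    (suc k) _ = refl
Δℕ-interval zero    (suc v) (suc k) _ =
  trans (cong (λ q → bit (k <ᵇ v) - q) (<ᵇ-suc k v))
        (solve 2 (λ p q → p :- (p :+ q) := con 0ℚ :- q) refl (bit (k <ᵇ v)) (bit (v ≡ᵇ k)))
Δℕ-interval (suc u) (suc v) (suc zero)    (s≤s u≤v) = Δℕ-interval u v zero u≤v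
Δℕ-interval (suc u) (suc v) (suc (suc k)) (s≤s u≤v) = Δℕ-interval u v (suc k) u≤v

Δ-interval : ∀ {n} (u v : Fin n) → toℕ u ℕ.≤ toℕ v → Δ (interval (toℕ u) (toℕ v)) ≈ᵥ (e u -ᵥ e v)
Δ-interval u v u≤v i = trans (Δℕ-interval (toℕ u) (toℕ v) (toℕ i) u≤v) (sym (cong₂ _-_ (e-toℕ u i) (e-toℕ v i)))

Δ-∨ : ∀ {n} (f g : ℕ → Bool) → (∀ k → f k ≡ true → g k ≡ false) →
  Δ {n} (λ k → f k ∨ g k) ≈ᵥ (Δ f +ᵥ Δ g)
Δ-∨ f g disjoint i = trans (cong₂ _-_ (bit-∨ (f k) (g k) (disjoint k)) (bit-before k))
  (solve 4 (λ a b c d → (a :+ b) :- (c :+ d) := (a :- c) :+ (b :- d)) refl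
     (bit (f k)) (bit (g k)) (bit (before f k)) (bit (before g k)))
  where
  k : ℕ
  k = toℕ i
  bit-before : ∀ k → bit (before (λ j → f j ∨ g j) k) ≡ bit (before f k) + bit (before g k)
  bit-before zero    = refl
  bit-before (suc k) = bit-∨ (f k) (g k) (disjoint k)

Δ-cong : ∀ {n} (s s' : ℕ → Bool) → (∀ k → k ℕ.< n → s k ≡ s' k) → Δ {n} s ≈ᵥ Δ s'
Δ-cong {n} s s' s≡s' i = cong₂ _-_ (cong bit (s≡s' (toℕ i) (Finₚ.toℕ<n i))) (cong bit (before-≡ (toℕ i) (Finₚ.toℕ<n i)))
  where
  before-≡ : ∀ k → k ℕ.< n → before s k ≡ before s' k
  before-≡ zero    _     = refl
  before-≡ (suc k) k+1<n = s≡s' k (ℕₚ.<-trans (ℕₚ.n<1+n k) k+1<n)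

Δ-empty : ∀ {n} (s : ℕ → Bool) → (∀ k → s k ≡ false) → Δ {n} s ≈ᵥ 0ᵥ
Δ-empty s empty i = trans (Δ-cong s (λ _ → false) (λ k _ → empty k) i) (Δℕ-false (toℕ i))
  where
  Δℕ-false : ∀ k → Δℕ (λ _ → false) k ≡ 0ℚ
  Δℕ-false zero    = refl
  Δℕ-false (suc k) = refl

Δ-injective : ∀ {n} (s s' : ℕ → Bool) → Δ {n} s ≈ᵥ Δ s' → ∀ k → k ℕ.< n → s k ≡ s' k
Δ-injective {n} s s' Δs≈Δs' k k<n = bit-injective (begin
  bit (s k)                           ≡⟨ solve 2 (λ x p → x := (x :- p) :+ p) refl (bit (s k)) (bit (before s k)) ⟩
  Δℕ s k + bit (before s k)           ≡⟨ cong₂ _+_ Δℕs≡Δℕs' (cong bit (before-≡ k k<n)) ⟩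
  Δℕ s' k + bit (before s' k)         ≡⟨ solve 2 (λ x p → (x :- p) :+ p := x) refl (bit (s' k)) (bit (before s' k)) ⟩
  bit (s' k)                          ∎)
  where
  open ≡-Reasoning
  Δℕs≡Δℕs' : Δℕ s k ≡ Δℕ s' k
  Δℕs≡Δℕs' = subst (λ j → Δℕ s j ≡ Δℕ s' j) (Finₚ.toℕ-fromℕ< k<n) (Δs≈Δs' (Fin.fromℕ< k<n))
  before-≡ : ∀ k → k ℕ.< n → before s k ≡ before s' k
  before-≡ zero    _     = refl
  before-≡ (suc k) k+1<n = Δ-injective s s' Δs≈Δs' k (ℕₚ.<-trans (ℕₚ.n<1+n k) k+1<n)

RisesAt : (ℕ → Bool) → ℕ → Set
RisesAt s k = s k ≡ true × before s k ≡ false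

FallsAt : (ℕ → Bool) → ℕ → Set
FallsAt s k = s k ≡ false × before s k ≡ true

before-∨ : ∀ (f g : ℕ → Bool) k → before (λ j → f j ∨ g j) k ≡ before f k ∨ before g k
before-∨ f g zero    = refl
before-∨ f g (suc k) = refl

rises-∨ : ∀ (f g : ℕ → Bool) k → RisesAt (λ j → f j ∨ g j) k → RisesAt f k ⊎ RisesAt g k
rises-∨ f g k (fg-k , fg-before) with ∨≡true (f k) fg-k
... | inj₁ fk = inj₁ (fk , Boolₚ.∨-conicalˡ _ _ (trans (sym (before-∨ f g k)) fg-before))
... | inj₂ gk = inj₂ (gk , Boolₚ.∨-conicalʳ _ _ (trans (sym (before-∨ f g k)) fg-before))

falls-∨ : ∀ (f g : ℕ → Bool) k → FallsAt (λ j → f j ∨ g j) k → FallsAt f k ⊎ FallsAt g k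
falls-∨ f g k (fg-k , fg-before) with ∨≡true (before f k) (trans (sym (before-∨ f g k)) fg-before)
... | inj₁ fb = inj₁ (Boolₚ.∨-conicalˡ _ _ fg-k , fb)
... | inj₂ gb = inj₂ (Boolₚ.∨-conicalʳ _ _ fg-k , gb)

rises-interval : ∀ u v k → RisesAt (interval u v) k → k ≡ u
rises-interval u v zero    (inside , _)   = ℕₚ.≤-antisym z≤n (proj₁ (interval≡true⇒ {u} {v} inside))
rises-interval u v (suc k) (inside , prev) with interval≡true⇒ {u} {v} inside | interval≡false⇒ {u} {v} {k} prev
... | u≤k+1 , _     | inj₁ k<u = ℕₚ.≤-antisym k<u u≤k+1
... | _     , k+1<v | inj₂ v≤k = contradiction (ℕₚ.<-trans (ℕₚ.n<1+n k) k+1<v) (ℕₚ.≤⇒≯ v≤k)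

falls-interval : ∀ u v k → FallsAt (interval u v) k → k ≡ v
falls-interval u v (suc k) (outside , prev) with interval≡true⇒ {u} {v} prev | interval≡false⇒ {u} {v} {suc k} outside
... | u≤k , _   | inj₁ k+1<u = contradiction (ℕₚ.<-trans (ℕₚ.n<1+n k) k+1<u) (ℕₚ.≤⇒≯ u≤k)
... | _   , k<v | inj₂ v≤k+1 = ℕₚ.≤-antisym k<v v≤k+1

before-false : ∀ (s : ℕ → Bool) lo → (∀ k → k ℕ.< lo → s k ≡ false) → before s lo ≡ false
before-false s zero     _     = refl
before-false s (suc lo) below = below lo (ℕₚ.n<1+n lo)

before-true : ∀ (s : ℕ → Bool) {lo y} → lo ℕ.< y → (∀ k → lo ℕ.≤ k → k ℕ.< y → s k ≡ true) → before s y ≡ true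
before-true s {y = suc y} (s≤s lo≤y) run = run y lo≤y (ℕₚ.n<1+n y)

after : ℕ → (ℕ → Bool) → ℕ → Bool
after y s k = (y <ᵇ k) ∧ s k

after-below : ∀ y (s : ℕ → Bool) k → k ℕ.≤ y → after y s k ≡ false
after-below y s k k≤y rewrite ≥⇒<ᵇ≡false {y} {k} k≤y = refl

after-above : ∀ y (s : ℕ → Bool) k → y ℕ.< k → after y s k ≡ s k
after-above y s k y<k rewrite <⇒<ᵇ≡true y<k = refl

interval-∨-after : ∀ (s : ℕ → Bool) {lo y} → (∀ k → k ℕ.< lo → s k ≡ false) →
  (∀ k → lo ℕ.≤ k → k ℕ.< y → s k ≡ true) → s y ≡ false →
  ∀ k → s k ≡ interval lo y k ∨ after y s k
interval-∨-after s {lo} {y} below run sy k with k ℕₚ.<? y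
... | yes k<y rewrite after-below y s k (ℕₚ.<⇒≤ k<y) | Boolₚ.∨-identityʳ (interval lo y k) with k ℕₚ.<? lo
...   | yes k<lo = trans (below k k<lo) (sym (interval-outside {lo} {y} (inj₁ k<lo)))
...   | no  k≮lo = trans (run k (ℕₚ.≮⇒≥ k≮lo) k<y) (sym (interval-inside (ℕₚ.≮⇒≥ k≮lo) k<y))
interval-∨-after s {lo} {y} below run sy k | no k≮y
  rewrite interval-outside {lo} {y} {k} (inj₂ (ℕₚ.≮⇒≥ k≮y)) with y ℕₚ.≟ k
... | yes refl = trans sy (sym (after-below y s y ℕₚ.≤-refl))
... | no  y≢k  = sym (after-above y s k (ℕₚ.≤∧≢⇒< (ℕₚ.≮⇒≥ k≮y) y≢k))

first-false : ∀ (s : ℕ → Bool) j d → s (j ℕ.+ d) ≡ false →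
  ∃ λ y → j ℕ.≤ y × y ℕ.≤ j ℕ.+ d × s y ≡ false × (∀ k → j ℕ.≤ k → k ℕ.< y → s k ≡ true)
first-false s j zero s[j+0] =
  j , ℕₚ.≤-refl , ℕₚ.m≤m+n j 0 , subst (λ z → s z ≡ false) (ℕₚ.+-identityʳ j) s[j+0] ,
  λ k j≤k k<j → contradiction j≤k (ℕₚ.<⇒≱ k<j)
first-false s j (suc d) s[j+d+1] with s j in sj
... | false = j , ℕₚ.≤-refl , ℕₚ.m≤m+n j (suc d) , sj , λ k j≤k k<j → contradiction j≤k (ℕₚ.<⇒≱ k<j)
... | true with first-false s (suc j) d (subst (λ z → s z ≡ false) (ℕₚ.+-suc j d) s[j+d+1])
...   | y , j<y , y≤ , sy , run =
  y , ℕₚ.<⇒≤ j<y , subst (y ℕ.≤_) (sym (ℕₚ.+-suc j d)) y≤ , sy , run′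
  where
  run′ : ∀ k → j ℕ.≤ k → k ℕ.< y → s k ≡ true
  run′ k j≤k k<y with j ℕₚ.≟ k
  ... | yes refl = sj
  ... | no  j≢k  = run k (ℕₚ.≤∧≢⇒< j≤k j≢k) k<y

-- Alternating matchings as indicator sequences

toFin : ∀ {n} m → m ℕ.< n → ∃ λ (i : Fin n) → toℕ i ≡ m
toFin m m<n = fromℕ< m<n , Finₚ.toℕ-fromℕ< m<n

record Alternating {n} (α : Arc n) (s : ℕ → Bool) : Set where
  constructor alternating
  field
    support : ∀ k → s k ≡ true → toℕ (a α) ℕ.≤ k × k ℕ.< toℕ (b α)
    rises   : ∀ i → RisesAt s (toℕ i) → i ≡ a α ⊎ i ∈ A α
    falls   : ∀ i → FallsAt s (toℕ i) → i ∈ B α ⊎ i ≡ b α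
open Alternating public

AltPoint : ∀ {n} → Arc n → PointSet n
AltPoint α x = ∃ λ s → Alternating α s × x ≈ᵥ Δ s

AltPoint-resp : ∀ {n} (α : Arc n) → Resp≈ (AltPoint α)
AltPoint-resp α x≈y (s , alt , x≈Δs) = s , alt , ≈ᵥ-trans (≈ᵥ-sym x≈y) x≈Δs

MatchingPoint : ∀ {n} → Arc n → PointSet n
MatchingPoint α x = ∃ λ M → AltMatching α M × x ≈ᵥ χ M

intervals : ∀ {n} → List (Fin n × Fin n) → ℕ → Bool
intervals []            k = false
intervals ((x , y) ∷ M) k = interval (toℕ x) (toℕ y) k ∨ intervals M k

a≤left : ∀ {n} (α : Arc n) {x} → x ≡ a α ⊎ x ∈ A α → toℕ (a α) ℕ.≤ toℕ x
a≤left α (inj₁ refl) = ℕₚ.≤-refl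
a≤left α (inj₂ x∈A)  = ℕₚ.<⇒≤ (proj₁ (inside α _ (inj₁ x∈A)))

module _ {n} {α : Arc n} where

  intervals-lower : ∀ {lo M} → Chain α lo M → ∀ k → intervals M k ≡ true → lo ℕ.≤ k
  intervals-lower {M = (x , y) ∷ M} ((lo≤x , x<y , _) ∷ chain) k covered with ∨≡true (interval (toℕ x) (toℕ y) k) covered
  ... | inj₁ in-xy   = ℕₚ.≤-trans lo≤x (proj₁ (interval≡true⇒ {toℕ x} {toℕ y} in-xy))
  ... | inj₂ in-rest = ℕₚ.≤-trans lo≤x (ℕₚ.<⇒≤ (ℕₚ.<-≤-trans x<y (ℕₚ.<⇒≤ (intervals-lower chain k in-rest))))

  intervals-disjoint : ∀ (x : Fin n) {y : Fin n} {M} → Chain α (suc (toℕ y)) M →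
    ∀ k → interval (toℕ x) (toℕ y) k ≡ true → intervals M k ≡ false
  intervals-disjoint x {y} chain k in-xy = ≢true⇒≡false λ in-rest →
    ℕₚ.<-irrefl refl (ℕₚ.<-trans (proj₂ (interval≡true⇒ {toℕ x} {toℕ y} in-xy)) (intervals-lower chain k in-rest))

  χ≈Δintervals : ∀ {lo M} → Chain α lo M → χ M ≈ᵥ Δ (intervals M)
  χ≈Δintervals []                                      i = sym (Δ-empty (λ _ → false) (λ _ → refl) i)
  χ≈Δintervals {M = (x , y) ∷ M} ((_ , x<y , _) ∷ chain) i = sym (trans
    (Δ-∨ (interval (toℕ x) (toℕ y)) (intervals M) (intervals-disjoint x chain) i)
    (cong₂ _+_ (Δ-interval x y (ℕₚ.<⇒≤ x<y) i) (sym (χ≈Δintervals chain i))))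

  intervals-alternating : ∀ {lo M} → Chain α lo M → Alternating α (intervals M)
  intervals-alternating [] =
    alternating (λ _ ()) (λ _ ()) λ i (_ , before≡true) → contradiction before≡true (before≢true (toℕ i))
    where
    before≢true : ∀ k → before (λ _ → false) k ≢ true
    before≢true zero    ()
    before≢true (suc k) ()
  intervals-alternating {M = (x , y) ∷ M} ((_ , x<y , y≤b , x-left , y-right) ∷ chain) =
    alternating support′ rises′ falls′
    where
    rest : Alternating α (intervals M)
    rest = intervals-alternating chain
    support′ : ∀ k → intervals ((x , y) ∷ M) k ≡ true → toℕ (a α) ℕ.≤ k × k ℕ.< toℕ (b α)
    support′ k covered with ∨≡true (interval (toℕ x) (toℕ y) k) covered
    ... | inj₁ in-xy   = let x≤k , k<y = interval≡true⇒ {toℕ x} {toℕ y} in-xy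
                         in ℕₚ.≤-trans (a≤left α x-left) x≤k , ℕₚ.<-≤-trans k<y y≤b
    ... | inj₂ in-rest = support rest k in-rest
    rises′ : ∀ i → RisesAt (intervals ((x , y) ∷ M)) (toℕ i) → i ≡ a α ⊎ i ∈ A α
    rises′ i rise with rises-∨ (interval (toℕ x) (toℕ y)) (intervals M) (toℕ i) rise
    ... | inj₁ rise-xy   rewrite Finₚ.toℕ-injective (rises-interval (toℕ x) (toℕ y) (toℕ i) rise-xy) = x-left
    ... | inj₂ rise-rest = rises rest i rise-rest
    falls′ : ∀ i → FallsAt (intervals ((x , y) ∷ M)) (toℕ i) → i ∈ B α ⊎ i ≡ b α
    falls′ i fall with falls-∨ (interval (toℕ x) (toℕ y)) (intervals M) (toℕ i) fall
    ... | inj₁ fall-xy   rewrite Finₚ.toℕ-injective (falls-interval (toℕ x) (toℕ y) (toℕ i) fall-xy) = y-right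
    ... | inj₂ fall-rest = falls rest i fall-rest

  matching⇒alt : ∀ x → MatchingPoint α x → AltPoint α x
  matching⇒alt x (M , chain , x≈χ) = intervals M , intervals-alternating chain , ≈ᵥ-trans x≈χ (χ≈Δintervals chain)

  after-alternating : ∀ {s} y → Alternating α s → s y ≡ false → Alternating α (after y s)
  after-alternating {s} y alt sy = alternating support′ rises′ falls′
    where
    after-true : ∀ {k} → after y s k ≡ true → y ℕ.< k × s k ≡ true
    after-true {k} h = <ᵇ≡true⇒< (Boolₚ.∧-conicalˡ _ _ h) , Boolₚ.∧-conicalʳ (y <ᵇ k) _ h
    support′ : ∀ k → after y s k ≡ true → toℕ (a α) ℕ.≤ k × k ℕ.< toℕ (b α)
    support′ k h = support alt k (proj₂ (after-true h))
    before-s : ∀ k → y ℕ.< k → before (after y s) k ≡ false → before s k ≡ false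
    before-s (suc k) (s≤s y≤k) prev with y ℕₚ.≟ k
    ... | yes refl = sy
    ... | no  y≢k  = trans (sym (after-above y s k (ℕₚ.≤∧≢⇒< y≤k y≢k))) prev
    rises′ : ∀ i → RisesAt (after y s) (toℕ i) → i ≡ a α ⊎ i ∈ A α
    rises′ i (h , prev) = let y<i , si = after-true h in rises alt i (si , before-s (toℕ i) y<i prev)
    falls-s : ∀ k → after y s k ≡ false → before (after y s) k ≡ true → FallsAt s k
    falls-s (suc k) h prev = let y<k , sk = after-true prev in
      trans (sym (after-above y s (suc k) (ℕₚ.<-trans y<k (ℕₚ.n<1+n k)))) h , sk
    falls′ : ∀ i → FallsAt (after y s) (toℕ i) → i ∈ B α ⊎ i ≡ b α
    falls′ i (h , prev) = falls alt i (falls-s (toℕ i) h prev)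

  chain-weaken : ∀ {lo lo′ M} → lo ℕ.≤ lo′ → Chain α lo′ M → Chain α lo M
  chain-weaken lo≤lo′ []                          = []
  chain-weaken lo≤lo′ ((lo′≤x , conditions) ∷ chain) = (ℕₚ.≤-trans lo≤lo′ lo′≤x , conditions) ∷ chain

  b-outside : ∀ {s} → Alternating α s → s (toℕ (b α)) ≡ false
  b-outside alt = ≢true⇒≡false λ sb → ℕₚ.<-irrefl refl (proj₂ (support alt _ sb))

  first-interval : ∀ {s lo} → Alternating α s → (∀ k → k ℕ.< lo → s k ≡ false) → s lo ≡ true →
    ∃ λ y → lo ℕ.< y × y ℕ.≤ toℕ (b α) × s y ≡ false × (∀ k → lo ℕ.≤ k → k ℕ.< y → s k ≡ true)
  first-interval {s} {lo} alt below slo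
    with first-false s lo (toℕ (b α) ℕ.∸ lo) (subst (λ z → s z ≡ false) (sym (ℕₚ.m+[n∸m]≡n lo≤b)) (b-outside alt))
    where
    lo≤b : lo ℕ.≤ toℕ (b α)
    lo≤b = ℕₚ.<⇒≤ (proj₂ (support alt lo slo))
  ... | y , lo≤y , y≤b , sy , run =
    y , ℕₚ.≤∧≢⇒< lo≤y (λ { refl → contradiction (trans (sym slo) sy) λ () }) ,
    subst (y ℕ.≤_) (ℕₚ.m+[n∸m]≡n (ℕₚ.<⇒≤ (proj₂ (support alt lo slo)))) y≤b , sy , run

  chain-head : ∀ {s} → Alternating α s → (x y : Fin n) → toℕ x ℕ.< toℕ y → (∀ k → k ℕ.< toℕ x → s k ≡ false) →
    (∀ k → toℕ x ℕ.≤ k → k ℕ.< toℕ y → s k ≡ true) → s (toℕ y) ≡ false →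
    (x ≡ a α ⊎ x ∈ A α) × (y ∈ B α ⊎ y ≡ b α)
  chain-head {s} alt x y x<y below run sy =
    rises alt x (run (toℕ x) ℕₚ.≤-refl x<y , before-false s (toℕ x) below) ,
    falls alt y (sy , before-true s x<y run)

  alt⇒chain : ∀ f lo {s} → toℕ (b α) ℕ.≤ lo ℕ.+ f → (∀ k → k ℕ.< lo → s k ≡ false) → Alternating α s →
    ∃ λ M → Chain α lo M × (∀ k → intervals M k ≡ s k)
  alt⇒chain zero lo {s} b≤lo+0 below alt = [] , [] , λ k → sym (empty k)
    where
    empty : ∀ k → s k ≡ false
    empty k with s k in sk
    ... | false = refl
    ... | true  = trans (sym sk) (below k (ℕₚ.<-≤-trans (proj₂ (support alt k sk))
                                                         (subst (toℕ (b α) ℕ.≤_) (ℕₚ.+-identityʳ lo) b≤lo+0)))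
  alt⇒chain (suc f) lo {s} b≤lo+f+1 below alt with s lo in slo
  ... | false = let M , chain , M≗s = alt⇒chain f (suc lo) b≤lo+1+f below′ alt
                in M , chain-weaken (ℕₚ.n≤1+n lo) chain , M≗s
    where
    b≤lo+1+f : toℕ (b α) ℕ.≤ suc lo ℕ.+ f
    b≤lo+1+f = subst (toℕ (b α) ℕ.≤_) (ℕₚ.+-suc lo f) b≤lo+f+1
    below′ : ∀ k → k ℕ.< suc lo → s k ≡ false
    below′ k k<lo+1 with k ℕₚ.≟ lo
    ... | yes refl = slo
    ... | no  k≢lo = below k (ℕₚ.≤∧≢⇒< (ℕₚ.≤-pred k<lo+1) k≢lo)
  ... | true with first-interval alt below slo
  ...   | y , lo<y , y≤b , sy , run with toFin y (ℕₚ.≤-<-trans y≤b (Finₚ.toℕ<n (b α)))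
  ...   | y′ , refl with toFin lo (ℕₚ.<-trans lo<y (Finₚ.toℕ<n y′))
  ...   | x , refl =
    let M , chain , M≗after = alt⇒chain f (suc (toℕ y′)) b≤y+1+f (λ k k≤y → after-below (toℕ y′) s k (ℕₚ.≤-pred k≤y))
                                        (after-alternating (toℕ y′) alt sy)
        x-left , y-right = chain-head alt x y′ lo<y below run sy
    in (x , y′) ∷ M , (ℕₚ.≤-refl , lo<y , y≤b , x-left , y-right) ∷ chain ,
       λ k → trans (cong (interval (toℕ x) (toℕ y′) k ∨_) (M≗after k)) (sym (interval-∨-after s below run sy k))
    where
    b≤y+1+f : toℕ (b α) ℕ.≤ suc (toℕ y′) ℕ.+ f
    b≤y+1+f = ℕₚ.≤-trans (subst (toℕ (b α) ℕ.≤_) (ℕₚ.+-suc (toℕ x) f) b≤lo+f+1)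
                         (ℕₚ.+-monoˡ-≤ f (ℕₚ.m≤n⇒m≤1+n lo<y))

  alt⇒matching : ∀ x → AltPoint α x → MatchingPoint α x
  alt⇒matching x (s , alt , x≈Δs)
    with alt⇒chain (toℕ (b α)) (toℕ (a α)) (ℕₚ.m≤n+m _ _) below alt
    where
    below : ∀ k → k ℕ.< toℕ (a α) → s k ≡ false
    below k k<a = ≢true⇒≡false λ sk → ℕₚ.<⇒≱ k<a (proj₁ (support alt k sk))
  ... | M , chain , M≗s =
    M , chain , ≈ᵥ-trans x≈Δs (≈ᵥ-sym (≈ᵥ-trans (χ≈Δintervals chain) (Δ-cong _ _ (λ k _ → M≗s k))))

SP≐conv-alt : ∀ {n} (α : Arc n) → SP α ≐ conv (AltPoint α)
SP≐conv-alt α x = conv-mono matching⇒alt x , conv-mono alt⇒matching x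

-- Faces prescribed by patterns

sumℕ : ℕ → (ℕ → ℚ) → ℚ
sumℕ zero    f = 0ℚ
sumℕ (suc m) f = f 0 + sumℕ m (λ k → f (suc k))

sumFin-toℕ : ∀ n (f : ℕ → ℚ) → sumFin {n} (λ i → f (toℕ i)) ≡ sumℕ n f
sumFin-toℕ zero    f = refl
sumFin-toℕ (suc n) f = cong (f 0 +_) (sumFin-toℕ n (λ k → f (suc k)))

sumℕ-cong : ∀ m {f g : ℕ → ℚ} → (∀ k → k ℕ.< m → f k ≡ g k) → sumℕ m f ≡ sumℕ m g
sumℕ-cong zero    f≡g = refl
sumℕ-cong (suc m) f≡g = cong₂ _+_ (f≡g 0 (s≤s z≤n)) (sumℕ-cong m (λ k k<m → f≡g (suc k) (s≤s k<m)))

sumℕ-mono : ∀ m {f g : ℕ → ℚ} → (∀ k → f k ℚ.≤ g k) → sumℕ m f ℚ.≤ sumℕ m g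
sumℕ-mono zero    f≤g = ℚₚ.≤-refl
sumℕ-mono (suc m) f≤g = ℚₚ.+-mono-≤ (f≤g 0) (sumℕ-mono m (λ k → f≤g (suc k)))

sumℕ-tight : ∀ m {f g : ℕ → ℚ} → (∀ k → f k ℚ.≤ g k) → sumℕ m g ℚ.≤ sumℕ m f → ∀ k → k ℕ.< m → f k ≡ g k
sumℕ-tight (suc m) f≤g g≤f k k<m with +-tight (f≤g 0) (sumℕ-mono m (λ j → f≤g (suc j))) g≤f
sumℕ-tight (suc m) f≤g g≤f zero    _         | f0≡g0 , _    = f0≡g0
sumℕ-tight (suc m) f≤g g≤f (suc k) (s≤s k<m) | _     , rest = sumℕ-tight m (λ j → f≤g (suc j)) (ℚₚ.≤-reflexive (sym rest)) k k<m

suffix : ℕ → (ℕ → ℚ) → ℕ → ℚ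
suffix m w k = sumℕ (m ∸ k) (λ j → w (k ℕ.+ j))

-- Summation by parts, with p standing for s (-1).
summation-by-parts : ∀ m w (s : ℕ → Bool) p →
  sumℕ m (λ k → suffix m w k * (bit (s k) - bit (beforeFrom p s k))) ≡ sumℕ m (λ k → w k * bit (s k)) - sumℕ m w * bit p
summation-by-parts zero    w s p = solve 1 (λ q → con 0ℚ := con 0ℚ :- con 0ℚ :* q) refl (bit p)
summation-by-parts (suc m) w s p = trans
  (cong (sumℕ (suc m) w * (bit (s 0) - bit p) +_)
    (trans (sumℕ-cong m (λ k _ → cong (λ q → suffix m (λ j → w (suc j)) k * (bit (s (suc k)) - bit q)) (shifted k)))
           (summation-by-parts m (λ j → w (suc j)) (λ j → s (suc j)) (s 0))))
  (solve 5 (λ w0 sw s0 p sws → (w0 :+ sw) :* (s0 :- p) :+ (sws :- sw :* s0) := (w0 :* s0 :+ sws) :- (w0 :+ sw) :* p) refl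
     (w 0) (sumℕ m (λ j → w (suc j))) (bit (s 0)) (bit p) (sumℕ m (λ k → w (suc k) * bit (s (suc k)))))
  where
  shifted : ∀ k → s k ≡ beforeFrom (s 0) (λ j → s (suc j)) k
  shifted zero    = refl
  shifted (suc k) = refl

-- A pattern prescribes the values of a sequence at the positions where it is just β.
Pattern : Set
Pattern = ℕ → Maybe Bool

Matches : ℕ → Pattern → (ℕ → Bool) → Set
Matches n π s = ∀ k → k ℕ.< n → ∀ β → π k ≡ just β → s k ≡ β

weight : Maybe Bool → ℚ
weight nothing      = 0ℚ
weight (just true)  = 1ℚ
weight (just false) = - 1ℚ

optimum : Maybe Bool → ℚ
optimum (just true) = 1ℚ
optimum _           = 0ℚ

weight-≤ : ∀ m β → weight m * bit β ℚ.≤ optimum m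
weight-≤ nothing      true  = ℚₚ.≤ᵇ⇒≤ _
weight-≤ nothing      false = ℚₚ.≤ᵇ⇒≤ _
weight-≤ (just true)  true  = ℚₚ.≤ᵇ⇒≤ _
weight-≤ (just true)  false = ℚₚ.≤ᵇ⇒≤ _
weight-≤ (just false) true  = ℚₚ.≤ᵇ⇒≤ _
weight-≤ (just false) false = ℚₚ.≤ᵇ⇒≤ _

weight-optimal⇒ : ∀ m β → weight m * bit β ≡ optimum m → ∀ β′ → m ≡ just β′ → β ≡ β′
weight-optimal⇒ (just true)  true  _ .true  refl = refl
weight-optimal⇒ (just false) false _ .false refl = refl

weight-optimal⇐ : ∀ m β → (∀ β′ → m ≡ just β′ → β ≡ β′) → weight m * bit β ≡ optimum m
weight-optimal⇐ nothing      true  _ = refl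
weight-optimal⇐ nothing      false _ = refl
weight-optimal⇐ (just β′) β matches with matches β′ refl
weight-optimal⇐ (just true)  .true  _ | refl = refl
weight-optimal⇐ (just false) .false _ | refl = refl

functional : ∀ {n} → Pattern → Point n
functional {n} π i = suffix n (λ k → weight (π k)) (toℕ i)

⟨functional,Δ⟩ : ∀ {n} (π : Pattern) (s : ℕ → Bool) → ⟨ functional {n} π , Δ s ⟩ ≡ sumℕ n (λ k → weight (π k) * bit (s k))
⟨functional,Δ⟩ {n} π s =
  trans (sumFin-toℕ n (λ k → suffix n (λ k → weight (π k)) k * Δℕ s k))
    (trans (summation-by-parts n (λ k → weight (π k)) s false)
      (solve 2 (λ x y → x :- y :* con 0ℚ := x) refl _ (sumℕ n (λ k → weight (π k)))))

-- The face is cut out by the suffix sums of the weights: +1 where π prescribes true, -1 where it prescribes false.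
pattern-face : ∀ {n} (α : Arc n) (π : Pattern) (F : PointSet n) →
  (∀ x → F x → ∃ λ s → Alternating α s × Matches n π s × x ≈ᵥ Δ s) →
  (∀ s x → Alternating α s → Matches n π s → x ≈ᵥ Δ s → F x) →
  (∃ λ s → Alternating α s × Matches n π s) →
  IsFace (conv F) (SP α)
pattern-face {n} α π F F⇒alt alt⇒F (s₀ , alt₀ , match₀) =
  IsFace-respʳ (≐-sym (SP≐conv-alt α))
    (maximizers-face (AltPoint α) F c M bounded attains attained (Δ s₀ , alt⇒F s₀ (Δ s₀) alt₀ match₀ (λ i → refl)))
  where
  c : Point n
  c = functional π
  M : ℚ
  M = sumℕ n (λ k → optimum (π k))
  value : ∀ x s → x ≈ᵥ Δ s → ⟨ c , x ⟩ ≡ sumℕ n (λ k → weight (π k) * bit (s k))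
  value x s x≈Δs = trans (⟨⟩-congʳ c x≈Δs) (⟨functional,Δ⟩ {n} π s)
  bounded : ∀ x → AltPoint α x → ⟨ c , x ⟩ ℚ.≤ M
  bounded x (s , _ , x≈Δs) = ℚₚ.≤-trans (ℚₚ.≤-reflexive (value x s x≈Δs)) (sumℕ-mono n (λ k → weight-≤ (π k) (s k)))
  attains : ∀ x → F x → AltPoint α x × ⟨ c , x ⟩ ≡ M
  attains x Fx with F⇒alt x Fx
  ... | s , alt , match , x≈Δs =
    (s , alt , x≈Δs) , trans (value x s x≈Δs) (sumℕ-cong n (λ k k<n → weight-optimal⇐ (π k) (s k) (match k k<n)))
  attained : ∀ x → AltPoint α x → ⟨ c , x ⟩ ≡ M → F x
  attained x (s , alt , x≈Δs) cx≡M = alt⇒F s x alt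
    (λ k k<n → weight-optimal⇒ (π k) (s k)
       (sumℕ-tight n (λ k → weight-≤ (π k) (s k)) (ℚₚ.≤-reflexive (trans (sym cx≡M) (value x s x≈Δs))) k k<n))
    x≈Δs

conv-singleton : ∀ {n} (v : Point n) x → conv (λ y → y ≈ᵥ v) x → x ≈ᵥ v
conv-singleton {n} v x (L , terms , w≡1 , x≈L) i =
  trans (x≈L i) (trans (wsum-const L terms i) (trans (cong (_* v i) w≡1) (ℚₚ.*-identityˡ (v i))))
  where
  wsum-const : (L : List (ℚ × Point n)) → All (ConvTerm (λ y → y ≈ᵥ v)) L → ∀ i → wsum L i ≡ weights L * v i
  wsum-const []            []              i = sym (ℚₚ.*-zeroˡ (v i))
  wsum-const ((w , p) ∷ L) ((_ , p≈v) ∷ terms) i =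
    trans (cong₂ _+_ (cong (w *_) (p≈v i)) (wsum-const L terms i)) (sym (ℚₚ.*-distribʳ-+ (v i) w (weights L)))

alt-vertex : ∀ {n} (α : Arc n) {s} → Alternating α s → IsVertex (SP α) (Δ s)
alt-vertex α {s} alt = IsFace-respˡ (λ x → conv-singleton (Δ s) x , conv-extensive x)
  (pattern-face α (λ k → just (s k)) (λ y → y ≈ᵥ Δ s)
    (λ x x≈Δs → s , alt , (λ { k _ β refl → refl }) , x≈Δs)
    (λ s′ x _ match x≈Δs′ → ≈ᵥ-trans x≈Δs′ (Δ-cong s′ s (λ k k<n → match k k<n (s k) refl)))
    (s , alt , λ { k _ β refl → refl }))

vertex⇒∈ : ∀ {n} {P : PointSet n} {v} → IsVertex P v → P v
vertex⇒∈ (_ , vertex) = proj₁ (proj₁ (vertex _) (λ i → refl))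

IsVertex-⊕ : ∀ {n} {P : PointSet n} {v x} (t : Point n) → Resp≈ P → IsVertex P v → (x -ᵥ t) ≈ᵥ v → IsVertex (P ⊕ t) x
IsVertex-⊕ {v = v} {x} t P-resp vertex x-t≈v = IsFace-respˡ (λ y → to y , from y) (IsFace-⊕ t P-resp vertex)
  where
  to : ∀ y → (y -ᵥ t) ≈ᵥ v → y ≈ᵥ x
  to y y-t≈v i = trans (solve 2 (λ y t → y := (y :- t) :+ t) refl (y i) (t i))
    (trans (cong (_+ t i) (trans (y-t≈v i) (sym (x-t≈v i)))) (solve 2 (λ x t → (x :- t) :+ t := x) refl (x i) (t i)))
  from : ∀ y → y ≈ᵥ x → (y -ᵥ t) ≈ᵥ v
  from y y≈x i = trans (cong (_- t i) (y≈x i)) (x-t≈v i)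

-- (ii) Translated shard polytopes are faces

does≡true⇒ : ∀ {p} {P : Set p} (P? : Dec P) → does P? ≡ true → P
does≡true⇒ (yes p) _ = p

does≡false⇒ : ∀ {p} {P : Set p} (P? : Dec P) → does P? ≡ false → ¬ P
does≡false⇒ (no ¬p) _ = ¬p

before-∧ : ∀ d (f : ℕ → Bool) k → before (λ j → d ∧ f j) k ≡ d ∧ before f k
before-∧ d f zero    = sym (Boolₚ.∧-zeroʳ d)
before-∧ d f (suc k) = refl

rises-∧ : ∀ d (f : ℕ → Bool) k → RisesAt (λ j → d ∧ f j) k → d ≡ true × RisesAt f k
rises-∧ true f k rise = refl , rise

falls-∧ : ∀ d (f : ℕ → Bool) k → FallsAt (λ j → d ∧ f j) k → d ≡ true × FallsAt f k
falls-∧ true  f k fall = refl , fall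
falls-∧ false f k (_ , prev) = contradiction (trans (sym (before-∧ false f k)) prev) λ ()

Δ-∧-interval : ∀ {n} (d : Bool) (u v : Fin n) → toℕ u ℕ.≤ toℕ v →
  Δ (λ k → d ∧ interval (toℕ u) (toℕ v) k) ≈ᵥ ((if d then 1ℚ else 0ℚ) ·ᵥ (e u -ᵥ e v))
Δ-∧-interval true  u v u≤v i = trans (Δ-interval u v u≤v i) (sym (ℚₚ.*-identityˡ _))
Δ-∧-interval false u v u≤v i = trans (Δ-empty (λ _ → false) (λ _ → refl) i) (sym (ℚₚ.*-zeroˡ ((e u -ᵥ e v) i)))

before-interval : ∀ {u v} → u ℕ.< v → before (interval u v) v ≡ true
before-interval {u} {suc v} (s≤s u≤v) = interval-inside u≤v (ℕₚ.n<1+n v)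

-- The decisions of a ∈ B′ and b ∈ A′ are parameters so that, instantiated with _∈?_, translation is t α α′.
module Translation {n} (α α′ : Arc n) (forces : Forces α α′)
                   (a∈B′? : Dec (a α ∈ B α′)) (b∈A′? : Dec (b α ∈ A α′)) where

  a₀ b₀ a₁ b₁ : ℕ
  a₀ = toℕ (a α)
  b₀ = toℕ (b α)
  a₁ = toℕ (a α′)
  b₁ = toℕ (b α′)

  d₁ d₂ : Bool
  d₁ = does a∈B′?
  d₂ = does b∈A′?

  a₁≤a₀ : a₁ ℕ.≤ a₀
  a₁≤a₀ = proj₁ forces
  b₀≤b₁ : b₀ ℕ.≤ b₁
  b₀≤b₁ = proj₁ (proj₂ forces)
  A⊆A′ : ∀ {i} → i ∈ A α → i ∈ A α′
  A⊆A′ = proj₁ (proj₂ (proj₂ forces))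
  B⊆B′ : ∀ {i} → i ∈ B α → i ∈ B α′
  B⊆B′ = proj₂ (proj₂ (proj₂ forces))
  a₀<b₀ : a₀ ℕ.< b₀
  a₀<b₀ = a<b α

  left : ℕ → Bool
  left k = d₁ ∧ interval a₁ a₀ k

  right : ℕ → Bool
  right k = d₂ ∧ interval b₀ b₁ k

  extend : (ℕ → Bool) → ℕ → Bool
  extend s k = left k ∨ (s k ∨ right k)

  translation : Point n
  translation = (δ a∈B′? ·ᵥ (e (a α′) -ᵥ e (a α))) +ᵥ (δ b∈A′? ·ᵥ (e (b α) -ᵥ e (b α′)))

  left≡true⇒ : ∀ {k} → left k ≡ true → d₁ ≡ true × a₁ ℕ.≤ k × k ℕ.< a₀
  left≡true⇒ {k} h = Boolₚ.∧-conicalˡ d₁ _ h , interval≡true⇒ {a₁} {a₀} (Boolₚ.∧-conicalʳ d₁ _ h)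

  right≡true⇒ : ∀ {k} → right k ≡ true → d₂ ≡ true × b₀ ℕ.≤ k × k ℕ.< b₁
  right≡true⇒ {k} h = Boolₚ.∧-conicalˡ d₂ _ h , interval≡true⇒ {b₀} {b₁} (Boolₚ.∧-conicalʳ d₂ _ h)

  left-outside : ∀ {k} → k ℕ.< a₁ ⊎ a₀ ℕ.≤ k → left k ≡ false
  left-outside out = trans (cong (d₁ ∧_) (interval-outside out)) (Boolₚ.∧-zeroʳ d₁)

  right-outside : ∀ {k} → k ℕ.< b₀ ⊎ b₁ ℕ.≤ k → right k ≡ false
  right-outside out = trans (cong (d₂ ∧_) (interval-outside out)) (Boolₚ.∧-zeroʳ d₂)

  left-inside : ∀ {k} → a₁ ℕ.≤ k → k ℕ.< a₀ → left k ≡ d₁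
  left-inside a₁≤k k<a₀ = trans (cong (d₁ ∧_) (interval-inside a₁≤k k<a₀)) (Boolₚ.∧-identityʳ d₁)

  right-inside : ∀ {k} → b₀ ℕ.≤ k → k ℕ.< b₁ → right k ≡ d₂
  right-inside b₀≤k k<b₁ = trans (cong (d₂ ∧_) (interval-inside b₀≤k k<b₁)) (Boolₚ.∧-identityʳ d₂)

  right-below-a₀ : ∀ {k} → k ℕ.< a₀ → right k ≡ false
  right-below-a₀ k<a₀ = right-outside (inj₁ (ℕₚ.<-trans k<a₀ a₀<b₀))

  left-from-b₀ : ∀ {k} → b₀ ℕ.≤ k → left k ≡ false
  left-from-b₀ b₀≤k = left-outside (inj₂ (ℕₚ.≤-trans (ℕₚ.<⇒≤ a₀<b₀) b₀≤k))

  <b₁⇒<n : ∀ {k} → k ℕ.< b₁ → k ℕ.< n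
  <b₁⇒<n k<b₁ = ℕₚ.<-trans k<b₁ (Finₚ.toℕ<n (b α′))

  <a₀⇒<n : ∀ {k} → k ℕ.< a₀ → k ℕ.< n
  <a₀⇒<n k<a₀ = <b₁⇒<n (ℕₚ.<-≤-trans k<a₀ (ℕₚ.≤-trans (ℕₚ.<⇒≤ a₀<b₀) b₀≤b₁))

  a∉B′⇒ : ¬ (a α ∈ B α′) → a α ≡ a α′ ⊎ a α ∈ A α′
  a∉B′⇒ a∉B′ with a₁ ℕₚ.≟ a₀
  ... | yes a₁≡a₀ = inj₁ (Finₚ.toℕ-injective (sym a₁≡a₀))
  ... | no  a₁≢a₀ with cover α′ (a α) (ℕₚ.≤∧≢⇒< a₁≤a₀ a₁≢a₀ , ℕₚ.<-≤-trans a₀<b₀ b₀≤b₁)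
  ...   | inj₁ a∈A′ = inj₂ a∈A′
  ...   | inj₂ a∈B′ = contradiction a∈B′ a∉B′

  b∉A′⇒ : ¬ (b α ∈ A α′) → b α ∈ B α′ ⊎ b α ≡ b α′
  b∉A′⇒ b∉A′ with b₀ ℕₚ.≟ b₁
  ... | yes b₀≡b₁ = inj₂ (Finₚ.toℕ-injective b₀≡b₁)
  ... | no  b₀≢b₁ with cover α′ (b α) (ℕₚ.≤-<-trans a₁≤a₀ a₀<b₀ , ℕₚ.≤∧≢⇒< b₀≤b₁ b₀≢b₁)
  ...   | inj₁ b∈A′ = contradiction b∈A′ b∉A′
  ...   | inj₂ b∈B′ = inj₁ b∈B′

  -- When a ∈ B′ the added run ends just before a, so a is not a rise of the extension.
  left-before-a₀ : d₁ ≡ true → before left a₀ ≡ true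
  left-before-a₀ d₁≡true = trans (before-∧ d₁ (interval a₁ a₀) a₀)
    (cong₂ _∧_ d₁≡true (before-interval (proj₁ (inside α′ (a α) (inj₂ (does≡true⇒ a∈B′? d₁≡true))))))

  right-at-b₀ : d₂ ≡ true → right b₀ ≡ true
  right-at-b₀ d₂≡true = trans (right-inside ℕₚ.≤-refl (proj₂ (inside α′ (b α) (inj₁ (does≡true⇒ b∈A′? d₂≡true))))) d₂≡true

  data Region (k : ℕ) : Set where
    before-a′ : k ℕ.< a₁ → Region k
    left-run  : a₁ ℕ.≤ k → k ℕ.< a₀ → Region k
    middle    : a₀ ℕ.≤ k → k ℕ.< b₀ → Region k
    right-run : b₀ ℕ.≤ k → k ℕ.< b₁ → Region k
    after-b′  : b₁ ℕ.≤ k → Region k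

  region : ∀ k → Region k
  region k with k ℕₚ.<? a₁ | k ℕₚ.<? a₀ | k ℕₚ.<? b₀ | k ℕₚ.<? b₁
  ... | yes k<a₁ | _        | _        | _        = before-a′ k<a₁
  ... | no  k≮a₁ | yes k<a₀ | _        | _        = left-run (ℕₚ.≮⇒≥ k≮a₁) k<a₀
  ... | no  _    | no  k≮a₀ | yes k<b₀ | _        = middle (ℕₚ.≮⇒≥ k≮a₀) k<b₀
  ... | no  _    | no  _    | no  k≮b₀ | yes k<b₁ = right-run (ℕₚ.≮⇒≥ k≮b₀) k<b₁
  ... | no  _    | no  _    | no  _    | no  k≮b₁ = after-b′ (ℕₚ.≮⇒≥ k≮b₁)

  prescribed : ∀ {k} → Region k → Maybe Bool
  prescribed (left-run _ _)  = just d₁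
  prescribed (right-run _ _) = just d₂
  prescribed _               = nothing

  π : Pattern
  π k = prescribed (region k)

  extend≡ : ∀ s {k l m r} → left k ≡ l → s k ≡ m → right k ≡ r → extend s k ≡ l ∨ (m ∨ r)
  extend≡ _ l≡ m≡ r≡ = cong₂ _∨_ l≡ (cong₂ _∨_ m≡ r≡)

  module _ {s} (alt : Alternating α s) where

    outside-support : ∀ {k} → k ℕ.< a₀ ⊎ b₀ ℕ.≤ k → s k ≡ false
    outside-support (inj₁ k<a₀) = ≢true⇒≡false λ sk → ℕₚ.<⇒≱ k<a₀ (proj₁ (support alt _ sk))
    outside-support (inj₂ b₀≤k) = ≢true⇒≡false λ sk → ℕₚ.<⇒≱ (proj₂ (support alt _ sk)) b₀≤k

    Δ-extend : Δ (extend s) ≈ᵥ (Δ s +ᵥ translation)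
    Δ-extend i = begin
      Δ (extend s) i                           ≡⟨ Δ-∨ left (λ k → s k ∨ right k) left-disjoint i ⟩
      Δ left i + Δ (λ k → s k ∨ right k) i     ≡⟨ cong (Δ left i +_) (Δ-∨ s right right-disjoint i) ⟩
      Δ left i + (Δ s i + Δ right i)           ≡⟨ cong₂ (λ p q → p + (Δ s i + q)) (Δ-∧-interval d₁ (a α′) (a α) a₁≤a₀ i)
                                                                                 (Δ-∧-interval d₂ (b α) (b α′) b₀≤b₁ i) ⟩
      l + (Δ s i + r)                          ≡⟨ solve 3 (λ p x q → p :+ (x :+ q) := x :+ (p :+ q)) refl l (Δ s i) r ⟩
      Δ s i + translation i                    ∎
      where
      open ≡-Reasoning
      l r : ℚ
      l = δ a∈B′? * (e (a α′) -ᵥ e (a α)) i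
      r = δ b∈A′? * (e (b α) -ᵥ e (b α′)) i
      left-disjoint : ∀ k → left k ≡ true → s k ∨ right k ≡ false
      left-disjoint k h = let _ , _ , k<a₀ = left≡true⇒ h in
        cong₂ _∨_ (outside-support (inj₁ k<a₀)) (right-below-a₀ k<a₀)
      right-disjoint : ∀ k → s k ≡ true → right k ≡ false
      right-disjoint k sk = right-outside (inj₁ (proj₂ (support alt k sk)))

    extend-support : ∀ k → extend s k ≡ true → a₁ ℕ.≤ k × k ℕ.< b₁
    extend-support k h with ∨≡true (left k) h
    ... | inj₁ in-left = let _ , a₁≤k , k<a₀ = left≡true⇒ in-left in a₁≤k , ℕₚ.<-≤-trans (ℕₚ.<-trans k<a₀ a₀<b₀) b₀≤b₁
    ... | inj₂ h′ with ∨≡true (s k) h′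
    ...   | inj₁ sk = let a₀≤k , k<b₀ = support alt k sk in ℕₚ.≤-trans a₁≤a₀ a₀≤k , ℕₚ.<-≤-trans k<b₀ b₀≤b₁
    ...   | inj₂ in-right = let _ , b₀≤k , k<b₁ = right≡true⇒ in-right in
                            ℕₚ.≤-trans a₁≤a₀ (ℕₚ.≤-trans (ℕₚ.<⇒≤ a₀<b₀) b₀≤k) , k<b₁

    extend-rises : ∀ i → RisesAt (extend s) (toℕ i) → i ≡ a α′ ⊎ i ∈ A α′
    extend-rises i rise with rises-∨ left (λ k → s k ∨ right k) (toℕ i) rise
    ... | inj₁ rise-left =
      inj₁ (Finₚ.toℕ-injective (rises-interval a₁ a₀ (toℕ i) (proj₂ (rises-∧ d₁ (interval a₁ a₀) (toℕ i) rise-left))))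
    ... | inj₂ rise-rest with rises-∨ s right (toℕ i) rise-rest
    ...   | inj₂ rise-right =
      let d₂≡true , rise′ = rises-∧ d₂ (interval b₀ b₁) (toℕ i) rise-right in
      inj₂ (subst (_∈ A α′) (sym (Finₚ.toℕ-injective (rises-interval b₀ b₁ (toℕ i) rise′))) (does≡true⇒ b∈A′? d₂≡true))
    ...   | inj₁ rise-s with rises alt i rise-s
    ...     | inj₂ i∈A  = inj₂ (A⊆A′ i∈A)
    ...     | inj₁ refl = a∉B′⇒ (does≡false⇒ a∈B′? (≢true⇒≡false λ d₁≡true →
                            contradiction (trans (sym (left-before-a₀ d₁≡true)) left-before) λ ()))
      where
      left-before : before left a₀ ≡ false
      left-before = Boolₚ.∨-conicalˡ _ _ (trans (sym (before-∨ left (λ k → s k ∨ right k) a₀)) (proj₂ rise))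

    extend-falls : ∀ i → FallsAt (extend s) (toℕ i) → i ∈ B α′ ⊎ i ≡ b α′
    extend-falls i fall with falls-∨ left (λ k → s k ∨ right k) (toℕ i) fall
    ... | inj₁ fall-left =
      let d₁≡true , fall′ = falls-∧ d₁ (interval a₁ a₀) (toℕ i) fall-left in
      inj₁ (subst (_∈ B α′) (sym (Finₚ.toℕ-injective (falls-interval a₁ a₀ (toℕ i) fall′))) (does≡true⇒ a∈B′? d₁≡true))
    ... | inj₂ fall-rest with falls-∨ s right (toℕ i) fall-rest
    ...   | inj₂ fall-right =
      inj₂ (Finₚ.toℕ-injective (falls-interval b₀ b₁ (toℕ i) (proj₂ (falls-∧ d₂ (interval b₀ b₁) (toℕ i) fall-right))))
    ...   | inj₁ fall-s with falls alt i fall-s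
    ...     | inj₁ i∈B  = inj₁ (B⊆B′ i∈B)
    ...     | inj₂ refl = b∉A′⇒ (does≡false⇒ b∈A′? (≢true⇒≡false λ d₂≡true →
                            contradiction (trans (sym (right-at-b₀ d₂≡true)) (Boolₚ.∨-conicalʳ _ _ (proj₁ fall-rest))) λ ()))

    extend-alternating : Alternating α′ (extend s)
    extend-alternating = alternating extend-support extend-rises extend-falls

    extend-matches : Matches n π (extend s)
    extend-matches k _ β = matches (region k)
      where
      matches : (r : Region k) → prescribed r ≡ just β → extend s k ≡ β
      matches (left-run a₁≤k k<a₀) refl =
        trans (extend≡ s (left-inside a₁≤k k<a₀) (outside-support (inj₁ k<a₀)) (right-below-a₀ k<a₀))
              (Boolₚ.∨-identityʳ d₁)
      matches (right-run b₀≤k k<b₁) refl =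
        extend≡ s (left-from-b₀ b₀≤k) (outside-support (inj₂ b₀≤k)) (right-inside b₀≤k k<b₁)

  restrict : (ℕ → Bool) → ℕ → Bool
  restrict s′ k = interval a₀ b₀ k ∧ s′ k

  module _ {s′} (alt′ : Alternating α′ s′) where

    outside-support′ : ∀ {k} → k ℕ.< a₁ ⊎ b₁ ℕ.≤ k → s′ k ≡ false
    outside-support′ (inj₁ k<a₁) = ≢true⇒≡false λ sk → ℕₚ.<⇒≱ k<a₁ (proj₁ (support alt′ _ sk))
    outside-support′ (inj₂ b₁≤k) = ≢true⇒≡false λ sk → ℕₚ.<⇒≱ (proj₂ (support alt′ _ sk)) b₁≤k

    restrict-outside : ∀ {k} → k ℕ.< a₀ ⊎ b₀ ℕ.≤ k → restrict s′ k ≡ false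
    restrict-outside out = cong (_∧ s′ _) (interval-outside out)

    extend-restrict : Matches n π s′ → ∀ k → s′ k ≡ extend (restrict s′) k
    extend-restrict matches k with region k in reg
    ... | before-a′ k<a₁ =
      trans (outside-support′ (inj₁ k<a₁))
            (sym (extend≡ (restrict s′) (left-outside (inj₁ k<a₁)) (restrict-outside (inj₁ k<a₀)) (right-below-a₀ k<a₀)))
      where
      k<a₀ : k ℕ.< a₀
      k<a₀ = ℕₚ.<-≤-trans k<a₁ a₁≤a₀
    ... | left-run a₁≤k k<a₀ =
      trans (matches k (<a₀⇒<n k<a₀) d₁ (cong prescribed reg))
            (sym (trans (extend≡ (restrict s′) (left-inside a₁≤k k<a₀) (restrict-outside (inj₁ k<a₀)) (right-below-a₀ k<a₀))
                        (Boolₚ.∨-identityʳ d₁)))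
    ... | middle a₀≤k k<b₀ =
      sym (trans (extend≡ (restrict s′) (left-outside (inj₂ a₀≤k)) (cong (_∧ s′ k) (interval-inside a₀≤k k<b₀))
                          (right-outside (inj₁ k<b₀)))
                 (Boolₚ.∨-identityʳ (s′ k)))
    ... | right-run b₀≤k k<b₁ =
      trans (matches k (<b₁⇒<n k<b₁) d₂ (cong prescribed reg))
            (sym (extend≡ (restrict s′) (left-from-b₀ b₀≤k) (restrict-outside (inj₂ b₀≤k)) (right-inside b₀≤k k<b₁)))
    ... | after-b′ b₁≤k =
      trans (outside-support′ (inj₂ b₁≤k))
            (sym (extend≡ (restrict s′) (left-from-b₀ b₀≤k) (restrict-outside (inj₂ b₀≤k)) (right-outside (inj₂ b₁≤k))))
      where
      b₀≤k : b₀ ℕ.≤ k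
      b₀≤k = ℕₚ.≤-trans b₀≤b₁ b₁≤k

    restrict-before : ∀ k → a₀ ℕ.< k → k ℕ.≤ b₀ → before (restrict s′) k ≡ before s′ k
    restrict-before (suc k) (s≤s a₀≤k) k<b₀ = cong (_∧ s′ k) (interval-inside a₀≤k k<b₀)

    restrict-before≡true⇒ : ∀ k → before (restrict s′) k ≡ true → a₀ ℕ.< k × k ℕ.≤ b₀
    restrict-before≡true⇒ (suc k) h = let a₀≤k , k<b₀ = interval≡true⇒ {a₀} {b₀} (Boolₚ.∧-conicalˡ _ _ h) in s≤s a₀≤k , k<b₀

    restrict-rises : ∀ i → RisesAt (restrict s′) (toℕ i) → i ≡ a α ⊎ i ∈ A α
    restrict-rises i (h , prev) with interval≡true⇒ {a₀} {b₀} (Boolₚ.∧-conicalˡ _ _ h) | a₀ ℕₚ.≟ toℕ i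
    ... | _         , _    | yes a₀≡i = inj₁ (Finₚ.toℕ-injective (sym a₀≡i))
    ... | a₀≤i , i<b₀ | no a₀≢i
      with rises alt′ i (Boolₚ.∧-conicalʳ (interval a₀ b₀ (toℕ i)) _ h , trans (sym (restrict-before (toℕ i) a₀<i (ℕₚ.<⇒≤ i<b₀))) prev)
      where
      a₀<i : a₀ ℕ.< toℕ i
      a₀<i = ℕₚ.≤∧≢⇒< a₀≤i a₀≢i
    ...   | inj₁ refl  = contradiction a₁≤a₀ (ℕₚ.<⇒≱ (ℕₚ.≤∧≢⇒< a₀≤i a₀≢i))
    ...   | inj₂ i∈A′ with cover α i (ℕₚ.≤∧≢⇒< a₀≤i a₀≢i , i<b₀)
    ...     | inj₁ i∈A = inj₂ i∈A
    ...     | inj₂ i∈B = contradiction (B⊆B′ i∈B) (disj α′ i i∈A′)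

    restrict-falls : ∀ i → FallsAt (restrict s′) (toℕ i) → i ∈ B α ⊎ i ≡ b α
    restrict-falls i (h , prev) with restrict-before≡true⇒ (toℕ i) prev | toℕ i ℕₚ.≟ b₀
    ... | _         , _    | yes i≡b₀ = inj₂ (Finₚ.toℕ-injective i≡b₀)
    ... | a₀<i , i≤b₀ | no i≢b₀
      with falls alt′ i (trans (sym (cong (_∧ s′ (toℕ i)) (interval-inside (ℕₚ.<⇒≤ a₀<i) i<b₀))) h ,
                         trans (sym (restrict-before (toℕ i) a₀<i i≤b₀)) prev)
      where
      i<b₀ : toℕ i ℕ.< b₀
      i<b₀ = ℕₚ.≤∧≢⇒< i≤b₀ i≢b₀
    ...   | inj₂ refl = contradiction b₀≤b₁ (ℕₚ.<⇒≱ (ℕₚ.≤∧≢⇒< i≤b₀ i≢b₀))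
    ...   | inj₁ i∈B′ with cover α i (a₀<i , ℕₚ.≤∧≢⇒< i≤b₀ i≢b₀)
    ...     | inj₁ i∈A = contradiction i∈B′ (disj α′ i (A⊆A′ i∈A))
    ...     | inj₂ i∈B = inj₁ i∈B

    restrict-alternating : Alternating α (restrict s′)
    restrict-alternating =
      alternating (λ k h → interval≡true⇒ {a₀} {b₀} (Boolₚ.∧-conicalˡ _ _ h)) restrict-rises restrict-falls

  translated-face : IsFace (SP α ⊕ translation) (SP α′)
  translated-face = IsFace-respˡ conv≐SP⊕t
    (pattern-face α′ π (AltPoint α ⊕ translation) to from
      (extend (λ _ → false) , extend-alternating empty , extend-matches empty))
    where
    empty : Alternating α (λ _ → false)
    empty = intervals-alternating {α = α} {lo = 0} []
    conv≐SP⊕t : conv (AltPoint α ⊕ translation) ≐ (SP α ⊕ translation)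
    conv≐SP⊕t = ≐-trans (≐-sym (conv-⊕ (AltPoint α) translation (AltPoint-resp α)))
                        (λ x → ≐-sym (SP≐conv-alt α) (x -ᵥ translation))
    to : ∀ x → (AltPoint α ⊕ translation) x → ∃ λ s′ → Alternating α′ s′ × Matches n π s′ × x ≈ᵥ Δ s′
    to x (s , alt , x-t≈Δs) = extend s , extend-alternating alt , extend-matches alt , λ i →
      trans (solve 2 (λ x t → x := (x :- t) :+ t) refl (x i) (translation i))
            (trans (cong (_+ translation i) (x-t≈Δs i)) (sym (Δ-extend alt i)))
    from : ∀ s′ x → Alternating α′ s′ → Matches n π s′ → x ≈ᵥ Δ s′ → (AltPoint α ⊕ translation) x
    from s′ x alt′ matches x≈Δs′ = restrict s′ , restrict-alternating alt′ , λ i →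
      trans (cong (_- translation i) (trans (x≈Δs′ i) (Δ-cong s′ (extend (restrict s′)) (λ k _ → extend-restrict alt′ matches k) i)))
        (trans (cong (_- translation i) (Δ-extend (restrict-alternating alt′) i))
               (solve 2 (λ d t → (d :+ t) :- t := d) refl (Δ (restrict s′) i) (translation i)))

translated-face : ∀ {n} (α α′ : Arc n) → Forces α α′ → IsFace (SP α ⊕ t α α′) (SP α′)
translated-face α α′ forces = Translation.translated-face α α′ forces (a α ∈? B α′) (b α ∈? A α′)

-- (i) Faces among shard polytopes

matching-vertex : ∀ {n} (α : Arc n) {M} → AltMatching α M → IsVertex (SP α) (χ M)
matching-vertex α chain =
  IsFace-respˡ (λ x → (λ x≈Δ → ≈ᵥ-trans x≈Δ (≈ᵥ-sym (χ≈Δintervals chain))) ,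
                      (λ x≈χ → ≈ᵥ-trans x≈χ (χ≈Δintervals chain)))
    (alt-vertex α (intervals-alternating chain))

interval-endpoints : ∀ {n} (α′ : Arc n) {s′} (u v : Fin n) → toℕ u ℕ.< toℕ v → Alternating α′ s′ →
  (∀ k → k ℕ.< n → s′ k ≡ interval (toℕ u) (toℕ v) k) →
  (toℕ (a α′) ℕ.≤ toℕ u) × (toℕ v ℕ.≤ toℕ (b α′)) × (u ≡ a α′ ⊎ u ∈ A α′) × (v ∈ B α′ ⊎ v ≡ b α′)
interval-endpoints {n} α′ {s′} u v u<v alt′ s′≡ =
  proj₁ (support alt′ (toℕ u) s′u) , last≤ (toℕ v) refl ,
  rises alt′ u (s′u , before-u (toℕ u) refl) , falls alt′ v (s′v , before-v (toℕ v) refl)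
  where
  U V : ℕ
  U = toℕ u
  V = toℕ v
  s′u : s′ U ≡ true
  s′u = trans (s′≡ U (Finₚ.toℕ<n u)) (interval-inside ℕₚ.≤-refl u<v)
  s′v : s′ V ≡ false
  s′v = trans (s′≡ V (Finₚ.toℕ<n v)) (interval-outside {U} {V} (inj₂ ℕₚ.≤-refl))
  before-u : ∀ k → k ≡ U → before s′ k ≡ false
  before-u zero    _    = refl
  before-u (suc k) k+1≡U = trans (s′≡ k (ℕₚ.<-trans k<U (Finₚ.toℕ<n u))) (interval-outside {U} {V} (inj₁ k<U))
    where
    k<U : k ℕ.< U
    k<U = subst (k ℕ.<_) k+1≡U (ℕₚ.n<1+n k)
  s′-last : ∀ k → suc k ≡ V → s′ k ≡ true
  s′-last k k+1≡V = trans (s′≡ k (ℕₚ.<-trans k<V (Finₚ.toℕ<n v)))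
                          (interval-inside (ℕₚ.≤-pred (subst (U ℕ.<_) (sym k+1≡V) u<v)) k<V)
    where
    k<V : k ℕ.< V
    k<V = subst (k ℕ.<_) k+1≡V (ℕₚ.n<1+n k)
  before-v : ∀ k → k ≡ V → before s′ k ≡ true
  before-v zero    0≡V   = contradiction (subst (U ℕ.<_) (sym 0≡V) u<v) ℕₚ.n≮0
  before-v (suc k) k+1≡V = s′-last k k+1≡V
  last≤ : ∀ k → k ≡ V → k ℕ.≤ toℕ (b α′)
  last≤ zero    _     = z≤n
  last≤ (suc k) k+1≡V = proj₂ (support alt′ k (s′-last k k+1≡V))

module _ {n} {α α′ : Arc n} (face : IsFace (SP α) (SP α′)) where

  face-interval : ∀ {u v} → AltMatching α ((u , v) ∷ []) →
    (toℕ (a α′) ℕ.≤ toℕ u) × (toℕ v ℕ.≤ toℕ (b α′)) × (u ≡ a α′ ⊎ u ∈ A α′) × (v ∈ B α′ ⊎ v ≡ b α′)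
  face-interval {u} {v} chain@((_ , u<v , _) ∷ []) =
    endpoints (vertex-of-face (AltPoint α′) (χ M) (IsFace-respʳ (SP≐conv-alt α′) face) (matching-vertex α chain))
    where
    M : List (Fin n × Fin n)
    M = (u , v) ∷ []
    endpoints : (∃ λ g → AltPoint α′ g × g ≈ᵥ χ M) →
      (toℕ (a α′) ℕ.≤ toℕ u) × (toℕ v ℕ.≤ toℕ (b α′)) × (u ≡ a α′ ⊎ u ∈ A α′) × (v ∈ B α′ ⊎ v ≡ b α′)
    endpoints (g , (s′ , alt′ , g≈Δs′) , g≈χ) = interval-endpoints α′ u v u<v alt′ λ k k<n →
      trans (Δ-injective s′ (intervals M) (≈ᵥ-trans (≈ᵥ-sym g≈Δs′) (≈ᵥ-trans g≈χ (χ≈Δintervals chain))) k k<n)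
            (Boolₚ.∨-identityʳ _)

  face⇒forces : Forces α α′ × (a α ≡ a α′ ⊎ a α ∈ A α′) × (b α ∈ B α′ ⊎ b α ≡ b α′)
  face⇒forces = (a′≤a , b≤b′ , A⊆A′ , B⊆B′) , a-left , b-right
    where
    whole : (toℕ (a α′) ℕ.≤ toℕ (a α)) × (toℕ (b α) ℕ.≤ toℕ (b α′)) ×
            (a α ≡ a α′ ⊎ a α ∈ A α′) × (b α ∈ B α′ ⊎ b α ≡ b α′)
    whole = face-interval ((ℕₚ.≤-refl , a<b α , ℕₚ.≤-refl , inj₁ refl , inj₂ refl) ∷ [])
    a′≤a : toℕ (a α′) ℕ.≤ toℕ (a α)
    a′≤a = proj₁ whole
    b≤b′ : toℕ (b α) ℕ.≤ toℕ (b α′)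
    b≤b′ = proj₁ (proj₂ whole)
    a-left : a α ≡ a α′ ⊎ a α ∈ A α′
    a-left = proj₁ (proj₂ (proj₂ whole))
    b-right : b α ∈ B α′ ⊎ b α ≡ b α′
    b-right = proj₂ (proj₂ (proj₂ whole))
    inner-left : ∀ {i} → toℕ (a α) ℕ.< toℕ i → i ≡ a α′ ⊎ i ∈ A α′ → i ∈ A α′
    inner-left a<i (inj₁ refl) = contradiction a′≤a (ℕₚ.<⇒≱ a<i)
    inner-left a<i (inj₂ i∈A′) = i∈A′
    inner-right : ∀ {i} → toℕ i ℕ.< toℕ (b α) → i ∈ B α′ ⊎ i ≡ b α′ → i ∈ B α′
    inner-right i<b (inj₁ i∈B′) = i∈B′
    inner-right i<b (inj₂ refl) = contradiction b≤b′ (ℕₚ.<⇒≱ i<b)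
    A⊆A′ : A α ⊆ A α′
    A⊆A′ {i} i∈A = let a<i , i<b = inside α i (inj₁ i∈A) in
      inner-left a<i (proj₁ (proj₂ (proj₂ (face-interval ((ℕₚ.<⇒≤ a<i , i<b , ℕₚ.≤-refl , inj₂ i∈A , inj₂ refl) ∷ [])))))
    B⊆B′ : B α ⊆ B α′
    B⊆B′ {i} i∈B = let a<i , i<b = inside α i (inj₂ i∈B) in
      inner-right i<b (proj₂ (proj₂ (proj₂ (face-interval ((ℕₚ.≤-refl , a<i , ℕₚ.<⇒≤ i<b , inj₁ refl , inj₁ i∈B) ∷ [])))))

t≈0 : ∀ {n} (α α′ : Arc n) → ¬ (a α ∈ B α′) → ¬ (b α ∈ A α′) → t α α′ ≈ᵥ 0ᵥ
t≈0 α α′ a∉B′ b∉A′ i rewrite dec-false (a α ∈? B α′) a∉B′ | dec-false (b α ∈? A α′) b∉A′ =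
  solve 2 (λ x y → con 0ℚ :* x :+ con 0ℚ :* y := con 0ℚ) refl (e (a α′) i - e (a α) i) (e (b α) i - e (b α′) i)

forces⇒face : ∀ {n} {α α′ : Arc n} → Forces α α′ → (a α ≡ a α′ ⊎ a α ∈ A α′) → (b α ∈ B α′ ⊎ b α ≡ b α′) →
  IsFace (SP α) (SP α′)
forces⇒face {α = α} {α′} forces a-left b-right = IsFace-respˡ (λ x → conv-resp _ x-t≈x , conv-resp _ (≈ᵥ-sym x-t≈x))
  (translated-face α α′ forces)
  where
  left∉B′ : ∀ {x} → x ≡ a α′ ⊎ x ∈ A α′ → ¬ (x ∈ B α′)
  left∉B′ (inj₁ refl) x∈B′ = ℕₚ.<-irrefl refl (proj₁ (inside α′ _ (inj₂ x∈B′)))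
  left∉B′ (inj₂ x∈A′) x∈B′ = disj α′ _ x∈A′ x∈B′
  right∉A′ : ∀ {x} → x ∈ B α′ ⊎ x ≡ b α′ → ¬ (x ∈ A α′)
  right∉A′ (inj₁ x∈B′) x∈A′ = disj α′ _ x∈A′ x∈B′
  right∉A′ (inj₂ refl) x∈A′ = ℕₚ.<-irrefl refl (proj₂ (inside α′ _ (inj₁ x∈A′)))
  x-t≈x : ∀ {x} → (x -ᵥ t α α′) ≈ᵥ x
  x-t≈x {x} i = trans (cong (λ q → x i - q) (t≈0 α α′ (left∉B′ a-left) (right∉A′ b-right) i)) (ℚₚ.+-identityʳ (x i))

-- (iii) Generators of a shard polytope

above : ∀ {n} → ℕ → Subset n
above c = tabulate (λ i → c <ᵇ toℕ i)

∈above⇒ : ∀ {n c} {i : Fin n} → i ∈ above c → c ℕ.< toℕ i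
∈above⇒ {c = c} {i} i∈ = <ᵇ≡true⇒< (trans (sym (Vecₚ.lookup∘tabulate (λ j → c <ᵇ toℕ j) i)) (Vecₚ.[]=⇒lookup i∈))

∈above⁺ : ∀ {n c} {i : Fin n} → c ℕ.< toℕ i → i ∈ above c
∈above⁺ {c = c} {i} c<i = Vecₚ.lookup⇒[]= i _ (trans (Vecₚ.lookup∘tabulate (λ j → c <ᵇ toℕ j) i) (<⇒<ᵇ≡true c<i))

tail : ∀ {n} (α′ : Arc n) (c : Fin n) → toℕ (a α′) ℕ.< toℕ c → toℕ c ℕ.< toℕ (b α′) → Arc n
tail α′ c a′<c c<b′ = record
  { a = c ; b = b α′ ; a<b = c<b′
  ; A = A α′ ∩ above (toℕ c) ; B = B α′ ∩ above (toℕ c)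
  ; disj = λ i i∈A i∈B → disj α′ i (proj₁ (x∈p∩q⁻ _ _ i∈A)) (proj₁ (x∈p∩q⁻ _ _ i∈B))
  ; cover = cover′
  ; inside = inside′
  }
  where
  cover′ : ∀ i → toℕ c ℕ.< toℕ i × toℕ i ℕ.< toℕ (b α′) → i ∈ A α′ ∩ above (toℕ c) ⊎ i ∈ B α′ ∩ above (toℕ c)
  cover′ i (c<i , i<b′) with cover α′ i (ℕₚ.<-trans a′<c c<i , i<b′)
  ... | inj₁ i∈A′ = inj₁ (x∈p∩q⁺ (i∈A′ , ∈above⁺ c<i))
  ... | inj₂ i∈B′ = inj₂ (x∈p∩q⁺ (i∈B′ , ∈above⁺ c<i))
  inside′ : ∀ i → i ∈ A α′ ∩ above (toℕ c) ⊎ i ∈ B α′ ∩ above (toℕ c) → toℕ c ℕ.< toℕ i × toℕ i ℕ.< toℕ (b α′)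
  inside′ i (inj₁ i∈A) = let i∈A′ , i∈above = x∈p∩q⁻ _ _ i∈A in ∈above⇒ i∈above , proj₂ (inside α′ i (inj₁ i∈A′))
  inside′ i (inj₂ i∈B) = let i∈B′ , i∈above = x∈p∩q⁻ _ _ i∈B in ∈above⇒ i∈above , proj₂ (inside α′ i (inj₂ i∈B′))

module _ {n} (α′ : Arc n) (c : Fin n) (a′<c : toℕ (a α′) ℕ.< toℕ c) (c<b′ : toℕ c ℕ.< toℕ (b α′)) where

  private
    τ : Arc n
    τ = tail α′ c a′<c c<b′

  tail-cuts : Cuts τ α′
  tail-cuts = (ℕₚ.<⇒≤ a′<c , ℕₚ.≤-refl , (λ i∈A → proj₁ (x∈p∩q⁻ _ _ i∈A)) , (λ i∈B → proj₁ (x∈p∩q⁻ _ _ i∈B))) , inj₂ refl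

  tail-≠ : ¬ SameArc τ α′
  tail-≠ (c≡a′ , _) = ℕₚ.<-irrefl (cong toℕ (sym c≡a′)) a′<c

  t-tail : t τ α′ ≈ᵥ (δ (c ∈? B α′) ·ᵥ (e (a α′) -ᵥ e c))
  t-tail i = solve 3 (λ p q y → p :+ q :* (y :- y) := p) refl
    (δ (c ∈? B α′) * (e (a α′) i - e c i)) (δ (b α′ ∈? A α′)) (e (b α′) i)

  tail-right : ∀ {y} → toℕ c ℕ.< toℕ y → y ∈ B α′ ⊎ y ≡ b α′ → y ∈ B α′ ∩ above (toℕ c) ⊎ y ≡ b α′
  tail-right c<y (inj₁ y∈B′) = inj₁ (x∈p∩q⁺ (y∈B′ , ∈above⁺ c<y))
  tail-right c<y (inj₂ y≡b′) = inj₂ y≡b′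

  tail-chain : ∀ {lo M} → toℕ c ℕ.< lo → Chain α′ lo M → Chain τ lo M
  tail-chain c<lo [] = []
  tail-chain {M = (x , y) ∷ _} c<lo ((lo≤x , x<y , y≤b′ , x-left , y-right) ∷ chain) =
    (lo≤x , x<y , y≤b′ , inj₂ (left x-left) , tail-right c<y y-right) ∷ tail-chain (ℕₚ.<-trans c<y (ℕₚ.n<1+n (toℕ y))) chain
    where
    c<x : toℕ c ℕ.< toℕ x
    c<x = ℕₚ.<-≤-trans c<lo lo≤x
    c<y : toℕ c ℕ.< toℕ y
    c<y = ℕₚ.<-trans c<x x<y
    left : x ≡ a α′ ⊎ x ∈ A α′ → x ∈ A α′ ∩ above (toℕ c)
    left (inj₁ refl) = contradiction (ℕₚ.<-trans a′<c c<x) (ℕₚ.<-irrefl refl)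
    left (inj₂ x∈A′) = x∈p∩q⁺ (x∈A′ , ∈above⁺ c<x)

  tail-from : ∀ {y rest} → toℕ c ℕ.< toℕ y → toℕ y ℕ.≤ toℕ (b α′) → y ∈ B α′ ⊎ y ≡ b α′ →
    Chain α′ (suc (toℕ y)) rest → AltMatching τ ((c , y) ∷ rest)
  tail-from c<y y≤b′ y-right chain =
    (ℕₚ.≤-refl , c<y , y≤b′ , inj₁ refl , tail-right c<y y-right) ∷ tail-chain (ℕₚ.<-trans c<y (ℕₚ.n<1+n _)) chain

  tail-generator : ∀ {M x} → AltMatching τ M → (x -ᵥ t τ α′) ≈ᵥ χ M → Gen Cuts α′ x
  tail-generator chain x-t≈χ =
    inj₂ (inj₂ (τ , tail-cuts , tail-≠ , IsVertex-⊕ (t τ α′) (conv-resp _) (matching-vertex τ chain) x-t≈χ))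

-- A vertex χ(M) of SP(α′) other than 0 and e_{a′} - e_{b′} comes from the tail arc starting at the first
-- left endpoint of M if that is not a′, and otherwise at the first right endpoint of M.
matching⇒generator : ∀ {n} (α′ : Arc n) {M p} → AltMatching α′ M → p ≈ᵥ χ M → Gen Cuts α′ p
matching⇒generator α′ [] p≈0 = inj₁ p≈0
matching⇒generator α′ {(x , y) ∷ rest} {p} ((_ , x<y , y≤b′ , inj₂ x∈A′ , y-right) ∷ rest-chain) p≈χ =
  tail-generator α′ x a′<x x<b′ (tail-from α′ x a′<x x<b′ x<y y≤b′ y-right rest-chain) λ i →
    trans (cong (λ q → p i - q) (t-tail α′ x a′<x x<b′ i))
      (trans (cong (λ d → p i - (if d then 1ℚ else 0ℚ) * (e (a α′) i - e x i)) (dec-false (x ∈? B α′) (disj α′ x x∈A′)))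
             (trans (solve 2 (λ p y → p :- con 0ℚ :* y := p) refl (p i) (e (a α′) i - e x i)) (p≈χ i)))
  where
  a′<x : toℕ (a α′) ℕ.< toℕ x
  a′<x = proj₁ (inside α′ x (inj₁ x∈A′))
  x<b′ : toℕ x ℕ.< toℕ (b α′)
  x<b′ = ℕₚ.<-≤-trans x<y y≤b′
matching⇒generator α′ {(x , y) ∷ []} ((_ , x<y , y≤b′ , inj₁ refl , inj₂ refl) ∷ []) p≈χ =
  inj₂ (inj₁ λ i → trans (p≈χ i) (ℚₚ.+-identityʳ _))
matching⇒generator α′ {(x , y) ∷ _ ∷ _} ((_ , _ , _ , inj₁ refl , inj₂ refl) ∷ ((b′<x′ , x′<y′ , y′≤b′ , _) ∷ _)) _ =
  contradiction (ℕₚ.<-trans b′<x′ x′<y′) (ℕₚ.≤⇒≯ y′≤b′)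
matching⇒generator α′ {(x , y) ∷ rest} {p} ((_ , x<y , y≤b′ , inj₁ refl , inj₁ y∈B′) ∷ rest-chain) p≈χ =
  tail-generator α′ y x<y y<b′ (chain-weaken (ℕₚ.n≤1+n _) (tail-chain α′ y x<y y<b′ (ℕₚ.n<1+n _) rest-chain)) λ i →
    trans (cong (λ q → p i - q) (t-tail α′ y x<y y<b′ i))
      (trans (cong (λ d → p i - (if d then 1ℚ else 0ℚ) * (e x i - e y i)) (dec-true (y ∈? B α′) y∈B′))
             (trans (cong (_- (1ℚ * (e x i - e y i))) (p≈χ i))
                    (solve 3 (λ u v r → (u :- v :+ r) :- con 1ℚ :* (u :- v) := r) refl (e x i) (e y i) (χ rest i))))
  where
  y<b′ : toℕ y ℕ.< toℕ (b α′)
  y<b′ = proj₂ (inside α′ y (inj₂ y∈B′))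

generator⇒SP : ∀ {n} (α′ : Arc n) x → Gen Forces α′ x → SP α′ x
generator⇒SP α′ x (inj₁ x≈0) = conv-extensive x ([] , [] , x≈0)
generator⇒SP α′ x (inj₂ (inj₁ x≈e-e)) = conv-extensive x
  ((a α′ , b α′) ∷ [] , (ℕₚ.≤-refl , a<b α′ , ℕₚ.≤-refl , inj₁ refl , inj₂ refl) ∷ [] ,
   λ i → trans (x≈e-e i) (sym (ℚₚ.+-identityʳ _)))
generator⇒SP α′ x (inj₂ (inj₂ (α , forces , _ , vertex))) = IsFace⇒⊆ (translated-face α α′ forces) x (vertex⇒∈ vertex)

Gen-Cuts⇒Forces : ∀ {n} (α′ : Arc n) x → Gen Cuts α′ x → Gen Forces α′ x
Gen-Cuts⇒Forces α′ x (inj₁ x≈0)                         = inj₁ x≈0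
Gen-Cuts⇒Forces α′ x (inj₂ (inj₁ x≈e-e))                = inj₂ (inj₁ x≈e-e)
Gen-Cuts⇒Forces α′ x (inj₂ (inj₂ (α , cuts , ≠ , vertex))) = inj₂ (inj₂ (α , proj₁ cuts , ≠ , vertex))

SP⊆conv-Gen-Cuts : ∀ {n} (α′ : Arc n) x → SP α′ x → conv (Gen Cuts α′) x
SP⊆conv-Gen-Cuts α′ = conv-mono (λ x (M , chain , x≈χ) → matching⇒generator α′ chain x≈χ)

conv-Gen-Forces⊆SP : ∀ {n} (α′ : Arc n) x → conv (Gen Forces α′) x → SP α′ x
conv-Gen-Forces⊆SP α′ x c = conv-idem _ x (conv-mono (generator⇒SP α′) x c)

SP≐conv-Gen-Forces : ∀ {n} (α′ : Arc n) → SP α′ ≐ conv (Gen Forces α′)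
SP≐conv-Gen-Forces α′ x = conv-mono (Gen-Cuts⇒Forces α′) x ∘ SP⊆conv-Gen-Cuts α′ x , conv-Gen-Forces⊆SP α′ x

SP≐conv-Gen-Cuts : ∀ {n} (α′ : Arc n) → SP α′ ≐ conv (Gen Cuts α′)
SP≐conv-Gen-Cuts α′ x = SP⊆conv-Gen-Cuts α′ x , conv-Gen-Forces⊆SP α′ x ∘ conv-mono (Gen-Cuts⇒Forces α′) x

proposition46 : ∀ {n} (α α' : Arc n) →
    -- (i)
    ((IsFace (SP α) (SP α') →
        Forces α α' × (a α ≡ a α' ⊎ a α ∈ A α') × (b α ∈ B α' ⊎ b α ≡ b α'))
     × (Forces α α' × (a α ≡ a α' ⊎ a α ∈ A α') × (b α ∈ B α' ⊎ b α ≡ b α') →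
        IsFace (SP α) (SP α')))
    -- (ii)
    × (Forces α α' → IsFace (SP α ⊕ t α α') (SP α'))
    -- (iii)
    × (SP α' ≐ conv (Gen Forces α'))
    × (SP α' ≐ conv (Gen Cuts α'))
proposition46 α α' =
  (face⇒forces , λ (forces , a-left , b-right) → forces⇒face forces a-left b-right) ,
  translated-face α α' ,
  SP≐conv-Gen-Forces α' ,
  SP≐conv-Gen-Cuts α'
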